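{- The set of lines of $\mathrm{PG}(3,q)$ contained in some osculating plane of $\mathcal C$ and not belonging to $\mathcal L_1\cup\mathcal L_2\cup\mathcal L_3\cup\mathcal L_4$ forms a single $G$-orbit $\mathcal L_5$.
   Context: Let $q$ be a power of an odd prime with $3\nmid q$. In $\mathrm{PG}(3,q)$ with homogeneous coordinates $(Y_0,Y_1,Y_2,Y_3)$, let $\mathcal{C}=\{P(t)=(1,t,t^2,t^3): t\in\mathbb{F}_q\}\cup\{P(\infty)=(0,0,0,1)\}$ be the twisted cubic. Let $G\le \mathrm{PGL}(4,q)$ be the group of projectivities induced by the matrices $\begin{pmatrix} a^3&a^2b&ab^2&b^3\\ 3a^2c&a^2d+2abc&b^2c+2abd&3b^2d\\ 3ac^2&bc^2+2acd&ad^2+2bcd&3bd^2\\ c^3&c^2d&cd^2&d^3\end{pmatrix}$ with $a,b,c,d\in\mathbb{F}_q$, $ad-bc\neq0$. The osculating plane at $P(t)$ is $\Pi(t): -t^3Y_0+3t^2Y_1-3tY_2+Y_3=0$, and $\Pi(\infty): Y_0=0$. The tangent line of $\mathcal C$ at $P(t)$ is the line joining $P(t)$ and $(0,1,2t,3t^2)$; at $P(\infty)$ it is $Y_0=Y_1=0$. $\mathcal L_1$: lines that are the intersection of two distinct osculating planes. $\mathcal L_2$: tangent lines of $\mathcal C$. $\mathcal L_3$: lines through a point $P\in\mathcal C$ contained in the osculating plane at $P$, other than the tangent line at $P$. $\mathcal L_4$: lines $\Pi_1\cap\Pi_2$ where $\Pi_1$ is the osculating plane at a point $P\in\mathcal C$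 and $\Pi_2$ is a non-osculating plane meeting $\mathcal C$ in exactly two ($\mathbb F_q$-)points and not containing $P$. -}

module Defs where

open import Level using (0ℓ)
open import Algebra.Bundles using (CommutativeRing)
open import Data.Fin using (Fin; zero; suc)
open import Data.List using (List)
open import Data.List.Membership.Setoid using ()
open import Data.List.Relation.Unary.Any using (Any)
open import Data.Product using (Σ; ∃; ∃-syntax; _×_; _,_)
open import Data.Sum using (_⊎_)
open import Relation.Nullary using (¬_; Dec)
open import Function.Bundles using (_⇔_)
open import Data.Empty using (⊥)
open import Data.Unit using (⊤)

record FiniteField : Set₁ where
  field
    commRing : CommutativeRing 0ℓ 0ℓ
  open CommutativeRing commRing public
  field
    1≉0      : ¬ (1# ≈ 0#)
    inverse  : ∀ x → ¬ (x ≈ 0#) → ∃[ y ] (x * y ≈ 1#)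
    _≟_      : ∀ x y → Dec (x ≈ y)
    elements : List Carrier
    complete : ∀ x → Any (x ≈_) elements

module Geometry (F : FiniteField) where
  open FiniteField F hiding (zero)

  2# 3# : Carrier
  2# = 1# + 1#
  3# = 1# + 1# + 1#

  -- characteristic ≠ 2, 3 (for F_q: q odd and 3 ∤ q)
  CharNot2Or3 : Set
  CharNot2Or3 = ¬ (2# ≈ 0#) × ¬ (3# ≈ 0#)

  -- vectors of F^4 (homogeneous coordinates Y0..Y3, or plane coordinates)
  V4 : Set
  V4 = Fin 4 → Carrier

  vec : Carrier → Carrier → Carrier → Carrier → V4
  vec a b c d zero = a
  vec a b c d (suc zero) = b
  vec a b c d (suc (suc zero)) = c
  vec a b c d (suc (suc (suc zero))) = d

  IsZeroVec : V4 → Set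
  IsZeroVec v = ∀ i → v i ≈ 0#

  -- proportional by a nonzero scalar: same projective point / same plane
  Proportional : V4 → V4 → Set
  Proportional u v = ∃[ c ] (c ≉ 0# × (∀ i → u i ≈ c * v i))

  dot : V4 → V4 → Carrier
  dot π v = π zero * v zero + π (suc zero) * v (suc zero)
          + π (suc (suc zero)) * v (suc (suc zero))
          + π (suc (suc (suc zero))) * v (suc (suc (suc zero)))

  OnPlane : V4 → V4 → Set
  OnPlane v π = dot π v ≈ 0#

  InSpan : V4 → V4 → V4 → Set
  InSpan w u v = ∃[ a ] ∃[ b ] (∀ i → w i ≈ a * u i + b * v i)

  record Line : Set where
    constructor line
    field
      p₁ p₂ : V4
      indep : ∀ a b → (∀ i → a * p₁ i + b * p₂ i ≈ 0#) → (a ≈ 0# × b ≈ 0#)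
  open Line public

  SpannedBy : Line → V4 → V4 → Set
  SpannedBy ℓ u v = (InSpan (p₁ ℓ) u v × InSpan (p₂ ℓ) u v)
                  × (InSpan u (p₁ ℓ) (p₂ ℓ) × InSpan v (p₁ ℓ) (p₂ ℓ))

  SameLine : Line → Line → Set
  SameLine ℓ m = SpannedBy ℓ (p₁ m) (p₂ m)

  OnLine : V4 → Line → Set
  OnLine w ℓ = InSpan w (p₁ ℓ) (p₂ ℓ)

  LineInPlane : Line → V4 → Set
  LineInPlane ℓ π = OnPlane (p₁ ℓ) π × OnPlane (p₂ ℓ) π

  IsPlane : V4 → Set
  IsPlane π = ¬ IsZeroVec π

  data Param : Set where
    fin : Carrier → Param
    ∞   : Param

  _≈ₚ_ : Param → Param → Set
  fin s ≈ₚ fin t = s ≈ t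
  fin _ ≈ₚ ∞     = ⊥
  ∞     ≈ₚ fin _ = ⊥
  ∞     ≈ₚ ∞     = ⊤

  P : Param → V4
  P (fin t) = vec 1# t (t * t) (t * t * t)
  P ∞       = vec 0# 0# 0# 1#

  Π : Param → V4
  Π (fin t) = vec (- (t * t * t)) (3# * (t * t)) (- (3# * t)) 1#
  Π ∞       = vec 1# 0# 0# 0#

  tan₁ tan₂ : Param → V4
  tan₁ (fin t) = P (fin t)
  tan₁ ∞ = vec 0# 0# 1# 0#
  tan₂ (fin t) = vec 0# 1# (2# * t) (3# * (t * t))
  tan₂ ∞ = vec 0# 0# 0# 1#

  IsTangentAt : Param → Line → Set
  IsTangentAt t ℓ = SpannedBy ℓ (tan₁ t) (tan₂ t)

  IsOsculatingPlane : V4 → Set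
  IsOsculatingPlane π = ∃[ t ] Proportional π (Π t)

  MeetsCInExactlyTwo : V4 → Set
  MeetsCInExactlyTwo π =
    ∃[ s₁ ] ∃[ s₂ ] (¬ (s₁ ≈ₚ s₂) × OnPlane (P s₁) π × OnPlane (P s₂) π
                     × (∀ s → OnPlane (P s) π → (s ≈ₚ s₁) ⊎ (s ≈ₚ s₂)))

  L₁ : Line → Set
  L₁ ℓ = ∃[ s ] ∃[ t ] (¬ Proportional (Π s) (Π t)
                         × LineInPlane ℓ (Π s) × LineInPlane ℓ (Π t))

  L₂ : Line → Set
  L₂ ℓ = ∃[ t ] IsTangentAt t ℓ

  L₃ : Line → Set
  L₃ ℓ = ∃[ t ] (OnLine (P t) ℓ × LineInPlane ℓ (Π t) × ¬ IsTangentAt t ℓ)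

  L₄ : Line → Set
  L₄ ℓ = ∃[ t ] ∃[ π₂ ] (IsPlane π₂ × ¬ IsOsculatingPlane π₂
                         × MeetsCInExactlyTwo π₂ × ¬ OnPlane (P t) π₂
                         × LineInPlane ℓ (Π t) × LineInPlane ℓ π₂)

  L₅ : Line → Set
  L₅ ℓ = (∃[ t ] LineInPlane ℓ (Π t))
       × ¬ L₁ ℓ × ¬ L₂ ℓ × ¬ L₃ ℓ × ¬ L₄ ℓ

  -- The group G: matrices M(a,b,c,d), ad - bc ≠ 0, acting on row
  -- vectors Y ↦ Y M (this convention maps P(t) to points of C).

  M : Carrier → Carrier → Carrier → Carrier → Fin 4 → Fin 4 → Carrier
  M a b c d zero = vec (a * a * a) (a * a * b) (a * b * b) (b * b * b)
  M a b c d (suc zero) = vec (3# * (a * a * c)) (a * a * d + 2# * (a * b * c))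
                             (b * b * c + 2# * (a * b * d)) (3# * (b * b * d))
  M a b c d (suc (suc zero)) = vec (3# * (a * c * c)) (b * c * c + 2# * (a * c * d))
                                   (a * d * d + 2# * (b * c * d)) (3# * (b * d * d))
  M a b c d (suc (suc (suc zero))) = vec (c * c * c) (c * c * d) (c * d * d) (d * d * d)

  _·_ : V4 → (Fin 4 → Fin 4 → Carrier) → V4
  (v · A) j = v zero * A zero j + v (suc zero) * A (suc zero) j
            + v (suc (suc zero)) * A (suc (suc zero)) j
            + v (suc (suc (suc zero))) * A (suc (suc (suc zero))) j

  -- ℓ' is the image of ℓ under the projectivity induced by M(a,b,c,d)
  -- (stated without needing a Line record for the image)
  ImageUnder : Carrier → Carrier → Carrier → Carrier → Line → Line → Set
  ImageUnder a b c d ℓ ℓ' = SpannedBy ℓ' (p₁ ℓ · M a b c d) (p₂ ℓ · M a b c d)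

  InOrbit : Line → Line → Set
  InOrbit ℓ ℓ' = ∃[ a ] ∃[ b ] ∃[ c ] ∃[ d ]
                   ((a * d + - (b * c)) ≉ 0# × ImageUnder a b c d ℓ ℓ')

  IsSingleOrbit : (Line → Set) → Set
  IsSingleOrbit S = ∃[ ℓ₀ ] (S ℓ₀ × (∀ ℓ → S ℓ ⇔ InOrbit ℓ₀ ℓ))

module Submission where

-- Points of C are V A B = (A³, A²B, AB², B³) and osculating planes are
-- W p q = (p³, 3p²q, 3pq², q³), with dot (W p q) (V A B) = (pA + qB)³; the
-- matrix M(a,b,c,d) acts on both by the substitution (A, B) ↦ (aA + cB, bA + dB),
-- so G permutes the points and osculating planes of C and preserves L₁, …, L₄.
-- A line of L₅ can thus be moved into Π∞ : Y₀ = 0, where, missing P∞, it is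
-- spanned by (0,1,0,γ) and (0,0,1,δ).  With D = δ² + 3γ the line lies in a
-- second osculating plane (L₁) when D = 0, in a plane meeting C in a double and
-- a simple point (L₄) when D is a nonzero square, and otherwise M(1, δ/3, 0, w/3n)
-- with w² = nD maps ℓ₀ : Y₀ = 0, Y₃ = 3nY₁ (n a fixed nonsquare) onto it; the
-- last case uses that a product of two nonsquares of F_q, q odd, is a square.

open import Defs
open import Algebra.Bundles using (CommutativeRing)
open import Data.Empty using (⊥; ⊥-elim)
open import Data.Fin as Fin using (Fin; zero; suc)
open import Data.Fin.Patterns using (0F; 1F; 2F; 3F)
import Data.Fin.Properties as Fin
open import Data.Integer as ℤ using (ℤ; +_; -[1+_]; _⊖_)
import Data.Integer.Properties as ℤ
open import Data.List using (List; length; lookup; deduplicate)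
open import Data.List.Relation.Unary.All using (All; _∷_)
import Data.List.Relation.Unary.Any as Any
open Any using (Any)
import Data.List.Relation.Unary.Any.Properties as Any
open import Data.List.Relation.Unary.Unique.Setoid using (Unique; _∷_)
open import Data.List.Relation.Unary.Unique.DecSetoid.Properties using (deduplicate-!)
open import Data.Maybe as Maybe using (Maybe)
open import Data.Nat as ℕ using (ℕ; zero; suc)
import Data.Nat.Properties as ℕ
open import Data.Product as Product using (_×_; _,_; proj₁; proj₂; ∃; ∃-syntax)
open import Data.Sign as Sign using (Sign)
open import Data.Sum as Sum using (_⊎_; inj₁; inj₂; [_,_]′)
open import Data.Unit using (tt)
open import Function using (id; _∘_)
open import Function.Bundles using (mk⇔)
open import Relation.Binary.Bundles using (DecSetoid)
open import Relation.Binary.Definitions using (tri<; tri≈; tri>)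
open import Relation.Binary.PropositionalEquality as ≡ using (_≡_)
open import Relation.Nullary using (¬_; ¬?; Dec; yes; no)
open import Relation.Nullary.Decidable using (dec⇒maybe)

module IntegerRingSolver {c ℓ} (CR : CommutativeRing c ℓ) where
  open import Algebra.Solver.Ring.AlmostCommutativeRing

  private
    R : AlmostCommutativeRing c ℓ
    R = fromCommutativeRing CR
    open AlmostCommutativeRing R
    open import Algebra.Properties.Ring (CommutativeRing.ring CR) using (-‿involutive; -0#≈0#)
    open import Algebra.Properties.CommutativeSemigroup (CommutativeRing.*-commutativeSemigroup CR) using (interchange)
    open import Relation.Binary.Reasoning.Setoid setoid

    sgn : Sign → Carrier
    sgn Sign.+ = 1#
    sgn Sign.- = - 1#

    -- Unfolds to 1#, 1# + 1#, 1# + 1# + 1#, …, so that the constants 2 and 3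
    -- of solver expressions evaluate to the 2# and 3# of Defs.
    nat : ℕ → Carrier
    nat zero = 0#
    nat (suc zero) = 1#
    nat (suc (suc n)) = nat (suc n) + 1#

    nat-suc : ∀ n → nat (suc n) ≈ nat n + 1#
    nat-suc zero = sym (+-identityˡ 1#)
    nat-suc (suc n) = refl

    nat-+ : ∀ m n → nat (m ℕ.+ n) ≈ nat m + nat n
    nat-+ zero n = sym (+-identityˡ _)
    nat-+ (suc m) n = begin
      nat (suc (m ℕ.+ n))  ≈⟨ nat-suc (m ℕ.+ n) ⟩
      nat (m ℕ.+ n) + 1#   ≈⟨ +-congʳ (nat-+ m n) ⟩
      nat m + nat n + 1#   ≈⟨ trans (+-assoc _ _ _) (trans (+-congˡ (+-comm _ _)) (sym (+-assoc _ _ _))) ⟩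
      nat m + 1# + nat n   ≈⟨ +-congʳ (sym (nat-suc m)) ⟩
      nat (suc m) + nat n  ∎

    nat-* : ∀ m n → nat (m ℕ.* n) ≈ nat m * nat n
    nat-* zero n = sym (zeroˡ _)
    nat-* (suc m) n = begin
      nat (n ℕ.+ m ℕ.* n)       ≈⟨ trans (nat-+ n (m ℕ.* n)) (+-congˡ (nat-* m n)) ⟩
      nat n + nat m * nat n     ≈⟨ trans (+-comm _ _) (+-congˡ (sym (*-identityˡ _))) ⟩
      nat m * nat n + 1# * nat n ≈⟨ sym (distribʳ _ _ _) ⟩
      (nat m + 1#) * nat n      ≈⟨ *-congʳ (sym (nat-suc m)) ⟩
      nat (suc m) * nat n       ∎

    fromℤ : ℤ → Carrier
    fromℤ (+ n) = nat n
    fromℤ -[1+ n ] = - nat (suc n)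

    fromℤ-⊖ : ∀ m n → fromℤ (m ⊖ n) ≈ nat m + - nat n
    fromℤ-⊖ zero zero = sym (trans (+-identityˡ _) -0#≈0#)
    fromℤ-⊖ zero (suc n) = sym (+-identityˡ _)
    fromℤ-⊖ (suc m) zero = sym (trans (+-congˡ -0#≈0#) (+-identityʳ _))
    fromℤ-⊖ (suc m) (suc n) = begin
      fromℤ (suc m ⊖ suc n)                ≡⟨ ≡.cong fromℤ (ℤ.[1+m]⊖[1+n]≡m⊖n m n) ⟩
      fromℤ (m ⊖ n)                        ≈⟨ fromℤ-⊖ m n ⟩
      nat m + - nat n                      ≈⟨ +-congʳ (sym (+-identityʳ _)) ⟩
      nat m + 0# + - nat n                 ≈⟨ +-congʳ (+-congˡ (sym (CommutativeRing.-‿inverseʳ CR 1#))) ⟩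
      nat m + (1# + - 1#) + - nat n        ≈⟨ trans (+-congʳ (sym (+-assoc _ _ _))) (+-assoc _ _ _) ⟩
      (nat m + 1#) + (- 1# + - nat n)      ≈⟨ +-cong (sym (nat-suc m)) (-‿+-comm _ _) ⟩
      nat (suc m) + - (1# + nat n)         ≈⟨ +-congˡ (-‿cong (trans (+-comm _ _) (sym (nat-suc n)))) ⟩
      nat (suc m) + - nat (suc n)          ∎

    fromℤ-+ : ∀ i j → fromℤ (i ℤ.+ j) ≈ fromℤ i + fromℤ j
    fromℤ-+ -[1+ m ] -[1+ n ] = begin
      - nat (suc (suc (m ℕ.+ n)))          ≈⟨ -‿cong (trans (nat-suc (suc (m ℕ.+ n))) (+-congʳ (nat-+ (suc m) n))) ⟩
      - (nat (suc m) + nat n + 1#)         ≈⟨ -‿cong (trans (+-assoc _ _ _) (+-congˡ (sym (nat-suc n)))) ⟩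
      - (nat (suc m) + nat (suc n))        ≈⟨ sym (-‿+-comm _ _) ⟩
      - nat (suc m) + - nat (suc n)        ∎
    fromℤ-+ -[1+ m ] (+ n) = trans (fromℤ-⊖ n (suc m)) (+-comm _ _)
    fromℤ-+ (+ m) -[1+ n ] = fromℤ-⊖ m (suc n)
    fromℤ-+ (+ m) (+ n) = nat-+ m n

    fromℤ-neg : ∀ i → fromℤ (ℤ.- i) ≈ - fromℤ i
    fromℤ-neg -[1+ n ] = sym (-‿involutive _)
    fromℤ-neg (+ zero) = sym -0#≈0#
    fromℤ-neg (+ suc n) = refl

    fromℤ-◃ : ∀ s n → fromℤ (s ℤ.◃ n) ≈ sgn s * nat n
    fromℤ-◃ s zero = sym (zeroʳ _)
    fromℤ-◃ Sign.+ (suc n) = sym (*-identityˡ _)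
    fromℤ-◃ Sign.- (suc n) = trans (-‿cong (sym (*-identityˡ _))) (sym (-‿*-distribˡ 1# _))

    sgn-* : ∀ s t → sgn (s Sign.* t) ≈ sgn s * sgn t
    sgn-* Sign.+ t = sym (*-identityˡ _)
    sgn-* Sign.- Sign.+ = sym (*-identityʳ _)
    sgn-* Sign.- Sign.- = begin
      1#            ≈⟨ sym (-‿involutive 1#) ⟩
      - - 1#        ≈⟨ -‿cong (sym (*-identityˡ _)) ⟩
      - (1# * - 1#) ≈⟨ sym (-‿*-distribˡ _ _) ⟩
      - 1# * - 1#   ∎

    fromℤ-sign : ∀ i → fromℤ i ≈ sgn (ℤ.sign i) * nat ℤ.∣ i ∣
    fromℤ-sign i = trans (reflexive (≡.cong fromℤ (≡.sym (ℤ.◃-inverse i)))) (fromℤ-◃ (ℤ.sign i) ℤ.∣ i ∣)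

    fromℤ-* : ∀ i j → fromℤ (i ℤ.* j) ≈ fromℤ i * fromℤ j
    fromℤ-* i j = begin
      fromℤ (i ℤ.* j)                                                   ≈⟨ fromℤ-◃ (ℤ.sign i Sign.* ℤ.sign j) (ℤ.∣ i ∣ ℕ.* ℤ.∣ j ∣) ⟩
      sgn (ℤ.sign i Sign.* ℤ.sign j) * nat (ℤ.∣ i ∣ ℕ.* ℤ.∣ j ∣)  ≈⟨ *-cong (sgn-* (ℤ.sign i) (ℤ.sign j)) (nat-* ℤ.∣ i ∣ ℤ.∣ j ∣) ⟩
      (sgn (ℤ.sign i) * sgn (ℤ.sign j)) * (nat ℤ.∣ i ∣ * nat ℤ.∣ j ∣) ≈⟨ interchange _ _ _ _ ⟩
      (sgn (ℤ.sign i) * nat ℤ.∣ i ∣) * (sgn (ℤ.sign j) * nat ℤ.∣ j ∣) ≈⟨ sym (*-cong (fromℤ-sign i) (fromℤ-sign j)) ⟩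
      fromℤ i * fromℤ j                                                     ∎

    embedding : ℤ.+-*-rawRing -Raw-AlmostCommutative⟶ R
    embedding = record
      { ⟦_⟧ = fromℤ ; +-homo = fromℤ-+ ; *-homo = fromℤ-* ; -‿homo = fromℤ-neg ; 0-homo = refl ; 1-homo = refl }

    fromℤ-≟ : ∀ i j → Maybe (fromℤ i ≈ fromℤ j)
    fromℤ-≟ i j = Maybe.map (λ i≡j → reflexive (≡.cong fromℤ i≡j)) (dec⇒maybe (i ℤ.≟ j))

  open import Algebra.Solver.Ring ℤ.+-*-rawRing R embedding fromℤ-≟ public
    using (solve; _:=_; Polynomial; con; _:+_; _:*_; :-_)

module FieldLemmas (F : FiniteField) where
  open FiniteField F
  open IntegerRingSolver commRing using (solve; _:=_; Polynomial; con; _:+_; _:*_; :-_)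
  open import Algebra.Properties.Ring ring public using (-‿involutive; -0#≈0#)
  open import Algebra.Properties.Group +-group public using () renaming (x≈y⇒x∙y⁻¹≈ε to x≈y⇒x-y≈0)
  open import Algebra.Properties.Group +-group using (x∙y⁻¹≈ε⇒x≈y)
  open import Relation.Binary.Reasoning.Setoid setoid

  recip : (x : Carrier) → x ≉ 0# → Carrier
  recip x x≉0 = proj₁ (inverse x x≉0)

  *-recip : ∀ x (x≉0 : x ≉ 0#) → x * recip x x≉0 ≈ 1#
  *-recip x x≉0 = proj₂ (inverse x x≉0)

  -- An equation L ≈ R holding modulo hypotheses Hᵢ ≈ 0# is proved by a
  -- certificate: a ring identity L = R + Σ cᵢ Hᵢ, checked by the solver.
  ≈-modulo : ∀ {L R} H c → L ≈ R + c * H → H ≈ 0# → L ≈ R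
  ≈-modulo {L} {R} H c e H≈0 = begin
    L          ≈⟨ e ⟩
    R + c * H  ≈⟨ +-congˡ (trans (*-congˡ H≈0) (zeroʳ c)) ⟩
    R + 0#     ≈⟨ +-identityʳ R ⟩
    R          ∎

  ≈-modulo₂ : ∀ {L R} H₁ c₁ H₂ c₂ → L ≈ R + c₁ * H₁ + c₂ * H₂ → H₁ ≈ 0# → H₂ ≈ 0# → L ≈ R
  ≈-modulo₂ H₁ c₁ H₂ c₂ e h₁ h₂ = ≈-modulo H₁ c₁ (≈-modulo H₂ c₂ e h₂) h₁

  ≈-modulo₃ : ∀ {L R} H₁ c₁ H₂ c₂ H₃ c₃ → L ≈ R + c₁ * H₁ + c₂ * H₂ + c₃ * H₃ →
              H₁ ≈ 0# → H₂ ≈ 0# → H₃ ≈ 0# → L ≈ R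
  ≈-modulo₃ H₁ c₁ H₂ c₂ H₃ c₃ e h₁ h₂ h₃ = ≈-modulo₂ H₁ c₁ H₂ c₂ (≈-modulo H₃ c₃ e h₃) h₁ h₂

  ≈-modulo₄ : ∀ {L R} H₁ c₁ H₂ c₂ H₃ c₃ H₄ c₄ → L ≈ R + c₁ * H₁ + c₂ * H₂ + c₃ * H₃ + c₄ * H₄ →
              H₁ ≈ 0# → H₂ ≈ 0# → H₃ ≈ 0# → H₄ ≈ 0# → L ≈ R
  ≈-modulo₄ H₁ c₁ H₂ c₂ H₃ c₃ H₄ c₄ e h₁ h₂ h₃ h₄ =
    ≈-modulo₃ H₁ c₁ H₂ c₂ H₃ c₃ (≈-modulo H₄ c₄ e h₄) h₁ h₂ h₃

  x-y≈0⇒x≈y : ∀ {x y} → x + - y ≈ 0# → x ≈ y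
  x-y≈0⇒x≈y = x∙y⁻¹≈ε⇒x≈y _ _

  -1≉0 : - 1# ≉ 0#
  -1≉0 e = 1≉0 (trans (sym (-‿involutive 1#)) (trans (-‿cong e) -0#≈0#))

  x*y≈0⇒x≈0⊎y≈0 : ∀ {x y} → x * y ≈ 0# → x ≈ 0# ⊎ y ≈ 0#
  x*y≈0⇒x≈0⊎y≈0 {x} {y} xy≈0 with x ≟ 0#
  ... | yes x≈0 = inj₁ x≈0
  ... | no x≉0 = inj₂ (≈-modulo₂ (x * y) (recip x x≉0) (x * recip x x≉0 + - 1#) (- y)
          (solve 3 (λ x y x⁻¹ → y := con (+ 0) :+ x⁻¹ :* (x :* y) :+ (:- y) :* (x :* x⁻¹ :+ :- con (+ 1))) refl x y (recip x x≉0))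
          xy≈0 (x≈y⇒x-y≈0 (*-recip x x≉0)))

  *+*≈0 : ∀ a b {x y} → x ≈ 0# → y ≈ 0# → a * x + b * y ≈ 0#
  *+*≈0 a b x≈0 y≈0 = trans (+-cong (trans (*-congˡ x≈0) (zeroʳ a)) (trans (*-congˡ y≈0) (zeroʳ b))) (+-identityʳ 0#)

  *-≉0 : ∀ {x y} → x ≉ 0# → y ≉ 0# → x * y ≉ 0#
  *-≉0 x≉0 y≉0 xy≈0 = [ x≉0 , y≉0 ]′ (x*y≈0⇒x≈0⊎y≈0 xy≈0)

  *-cancelˡ : ∀ {x y z} → x ≉ 0# → x * y ≈ x * z → y ≈ z
  *-cancelˡ {x} {y} {z} x≉0 e = [ ⊥-elim ∘ x≉0 , x-y≈0⇒x≈y ]′ (x*y≈0⇒x≈0⊎y≈0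
    (trans (solve 3 (λ x y z → x :* (y :+ :- z) := x :* y :+ :- (x :* z)) refl x y z) (x≈y⇒x-y≈0 e)))

  x*x≈0⇒x≈0 : ∀ {x} → x * x ≈ 0# → x ≈ 0#
  x*x≈0⇒x≈0 e = [ id , id ]′ (x*y≈0⇒x≈0⊎y≈0 e)

  cube : Carrier → Carrier
  cube x = x * x * x

  cube≈0⇒x≈0 : ∀ {x} → cube x ≈ 0# → x ≈ 0#
  cube≈0⇒x≈0 e = [ x*x≈0⇒x≈0 , id ]′ (x*y≈0⇒x≈0⊎y≈0 e)

  cube-≉0 : ∀ {x} → x ≉ 0# → cube x ≉ 0#
  cube-≉0 x≉0 = x≉0 ∘ cube≈0⇒x≈0

  x*x≈y*y⇒x≈±y : ∀ {x y} → x * x ≈ y * y → x ≈ y ⊎ x ≈ - y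
  x*x≈y*y⇒x≈±y {x} {y} e with x*y≈0⇒x≈0⊎y≈0 (trans (solve 2 (λ x y → (x :+ :- y) :* (x :+ y) := x :* x :+ :- (y :* y)) refl x y) (x≈y⇒x-y≈0 e))
  ... | inj₁ x-y≈0 = inj₁ (x-y≈0⇒x≈y x-y≈0)
  ... | inj₂ x+y≈0 = inj₂ (≈-modulo (x + y) 1# (solve 2 (λ x y → x := :- y :+ con (+ 1) :* (x :+ y)) refl x y) x+y≈0)

module Squares (F : FiniteField) where
  open FiniteField F
  open Geometry F using (2#)
  open FieldLemmas F
  open IntegerRingSolver commRing using (solve; _:=_; Polynomial; con; _:+_; _:*_; :-_)

  distinctElements : List Carrier
  distinctElements = deduplicate _≟_ elements

  private
    n : ℕ
    n = length distinctElements

    element : Fin n → Carrier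
    element = lookup distinctElements

    decSetoid : DecSetoid _ _
    decSetoid = record { isDecEquivalence = record { isEquivalence = isEquivalence ; _≟_ = _≟_ } }

    unique : Unique setoid distinctElements
    unique = deduplicate-! decSetoid elements

    complete! : ∀ x → Any (x ≈_) distinctElements
    complete! x = Any.deduplicate⁺ _≟_ (λ y≈z x≈y → trans x≈y (sym y≈z)) (complete x)

    ≉-lookup : ∀ {x xs} → All (x ≉_) xs → ∀ j → x ≉ lookup xs j
    ≉-lookup (x≉y ∷ _) zero = x≉y
    ≉-lookup (_ ∷ x≉ys) (suc j) = ≉-lookup x≉ys j

    lookup-injective : ∀ {xs} → Unique setoid xs → ∀ i j → lookup xs i ≈ lookup xs j → i ≡ j
    lookup-injective (_ ∷ _) zero zero _ = ≡.refl
    lookup-injective (x∉ ∷ _) zero (suc j) e = ⊥-elim (≉-lookup x∉ j e)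
    lookup-injective (x∉ ∷ _) (suc i) zero e = ⊥-elim (≉-lookup x∉ i (sym e))
    lookup-injective (_ ∷ u) (suc i) (suc j) e = ≡.cong suc (lookup-injective u i j e)

  index : Carrier → Fin n
  index x = Any.index (complete! x)

  x≈element[index] : ∀ x → x ≈ element (index x)
  x≈element[index] x = Any.lookup-result (complete! x)

  index-injective : ∀ {x y} → index x ≡ index y → x ≈ y
  index-injective {x} {y} e = trans (x≈element[index] x) (trans (reflexive (≡.cong element e)) (sym (x≈element[index] y)))

  index-cong : ∀ {x y} → x ≈ y → index x ≡ index y
  index-cong {x} {y} x≈y = lookup-injective unique (index x) (index y)
    (trans (sym (x≈element[index] x)) (trans x≈y (x≈element[index] y)))

  search : (P : Carrier → Set) → (∀ x → Dec (P x)) → (∀ {x y} → x ≈ y → P x → P y) → Dec (∃ P)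
  search P P? resp with Fin.any? (λ i → P? (element i))
  ... | yes (i , Pi) = yes (element i , Pi)
  ... | no ¬Pi = no λ (x , Px) → ¬Pi (index x , resp (x≈element[index] x) Px)

  injective⇒surjective : (f : Carrier → Carrier) → (∀ {x y} → f x ≈ f y → x ≈ y) → ∀ y → ∃[ x ] f x ≈ y
  injective⇒surjective f f-inj y with Fin.any? (λ i → f (element i) ≟ y)
  ... | yes (i , e) = element i , e
  ... | no miss = ⊥-elim (ℕ.<-irrefl ≡.refl (Fin.injective⇒≤ h-injective))
    where
    h : Fin (suc n) → Fin n
    h zero = index y
    h (suc i) = index (f (element i))
    h-injective : ∀ {i j} → h i ≡ h j → i ≡ j
    h-injective {zero} {zero} _ = ≡.refl
    h-injective {zero} {suc j} e = ⊥-elim (miss (j , sym (index-injective e)))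
    h-injective {suc i} {zero} e = ⊥-elim (miss (i , index-injective e))
    h-injective {suc i} {suc j} e = ≡.cong suc (lookup-injective unique i j (f-inj (index-injective e)))

  IsSquare : Carrier → Set
  IsSquare x = ∃[ y ] y * y ≈ x

  isSquare? : ∀ x → Dec (IsSquare x)
  isSquare? x = search (λ y → y * y ≈ x) (λ y → (y * y) ≟ x) (λ y≈z → trans (*-cong (sym y≈z) (sym y≈z)))

  isSquare-resp : ∀ {x y} → x ≈ y → IsSquare x → IsSquare y
  isSquare-resp x≈y (r , rr≈x) = r , trans rr≈x x≈y

  -- Half of the nonzero elements are declared positive: x is positive when
  -- it precedes - x in the enumeration.
  Positive : Carrier → Set
  Positive x = index x Fin.< index (- x)

  positive? : ∀ x → Dec (Positive x)
  positive? x = index x Fin.<? index (- x)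

  positive-resp : ∀ {x y} → x ≈ y → Positive x → Positive y
  positive-resp x≈y = ≡.subst₂ Fin._<_ (index-cong x≈y) (index-cong (-‿cong x≈y))

  private
    index[--x] : ∀ x → index (- - x) ≡ index x
    index[--x] x = index-cong (-‿involutive x)

  ¬positive-both : ∀ x → Positive x → ¬ Positive (- x)
  ¬positive-both x x<-x -x<x = Fin.<-asym x<-x (≡.subst (index (- x) Fin.<_) (index[--x] x) -x<x)

  0-not-positive : ¬ Positive 0#
  0-not-positive 0<-0 = Fin.<-irrefl (index-cong (sym -0#≈0#)) 0<-0

  module _ (2≉0 : 2# ≉ 0#) where

    x≉-x : ∀ {x} → x ≉ 0# → x ≉ - x
    x≉-x {x} x≉0 x≈-x = *-≉0 2≉0 x≉0
      (trans (solve 1 (λ x → con (+ 2) :* x := x :+ x) refl x) (trans (+-congˡ x≈-x) (-‿inverseʳ x)))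

    positive-or-negated : ∀ x → x ≉ 0# → Positive x ⊎ Positive (- x)
    positive-or-negated x x≉0 with Fin.<-cmp (index x) (index (- x))
    ... | tri< x<-x _ _ = inj₁ x<-x
    ... | tri≈ _ x=-x _ = ⊥-elim (x≉-x x≉0 (index-injective x=-x))
    ... | tri> _ _ -x<x = inj₂ (≡.subst (index (- x) Fin.<_) (≡.sym (index[--x] x)) -x<x)

    ratio-isSquare : ∀ {x y m} → y ≉ 0# → x * x ≈ m * (y * y) → IsSquare m
    ratio-isSquare {x} {y} {m} y≉0 e = x * y⁻¹ , ≈-modulo₂ (x * x + - (m * (y * y))) (y⁻¹ * y⁻¹) (y * y⁻¹ + - 1#) (m * (y * y⁻¹ + 1#))
        (solve 4 (λ x y m i → (x :* i) :* (x :* i) := m :+ (i :* i) :* (x :* x :+ :- (m :* (y :* y))) :+ (m :* (y :* i :+ con (+ 1))) :* (y :* i :+ :- con (+ 1))) refl x y m y⁻¹)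
        (x≈y⇒x-y≈0 e) (x≈y⇒x-y≈0 (*-recip y y≉0))
      where y⁻¹ = recip y y≉0

    -- x ↦ x² on positive x and x ↦ m x² otherwise is injective, hence onto;
    -- a preimage of the nonsquare m′ cannot be positive.
    nonSquare*nonSquare-isSquare : ∀ {m m′} → ¬ IsSquare m → ¬ IsSquare m′ → IsSquare (m * m′)
    nonSquare*nonSquare-isSquare {m} {m′} ¬□m ¬□m′ = square (injective⇒surjective θ θ-injective m′)
      where
      m≉0 : m ≉ 0#
      m≉0 m≈0 = ¬□m (0# , trans (zeroˡ 0#) (sym m≈0))

      θ : Carrier → Carrier
      θ x with positive? x
      ... | yes _ = x * x
      ... | no _ = m * (x * x)

      ±-positive : ∀ {x y} → Positive x → Positive y → x ≈ - y → ⊥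
      ±-positive {x} {y} px py x≈-y = ¬positive-both y py (positive-resp x≈-y px)

      ±-nonpositive : ∀ {x y} → ¬ Positive x → ¬ Positive y → x ≈ - y → x ≈ y
      ±-nonpositive {x} {y} ¬px ¬py x≈-y with y ≟ 0#
      ... | yes y≈0 = trans x≈-y (trans (-‿cong y≈0) (trans -0#≈0# (sym y≈0)))
      ... | no y≉0 = [ ⊥-elim ∘ ¬py , ⊥-elim ∘ ¬px ∘ positive-resp (sym x≈-y) ]′ (positive-or-negated y y≉0)

      positive≠nonpositive : ∀ {x y} → Positive x → ¬ Positive y → x * x ≈ m * (y * y) → ⊥
      positive≠nonpositive {x} {y} px ¬py e with y ≟ 0#
      ... | yes y≈0 = 0-not-positive (positive-resp (x*x≈0⇒x≈0 (trans e (trans (*-congˡ (*-cong y≈0 y≈0)) (trans (*-congˡ (zeroˡ 0#)) (zeroʳ m))))) px)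
      ... | no y≉0 = ¬□m (ratio-isSquare y≉0 e)

      θ-injective : ∀ {x y} → θ x ≈ θ y → x ≈ y
      θ-injective {x} {y} e with positive? x | positive? y
      ... | yes px | yes py = [ id , ⊥-elim ∘ ±-positive px py ]′ (x*x≈y*y⇒x≈±y e)
      ... | no ¬px | no ¬py = [ id , ±-nonpositive ¬px ¬py ]′ (x*x≈y*y⇒x≈±y (*-cancelˡ m≉0 e))
      ... | yes px | no ¬py = ⊥-elim (positive≠nonpositive px ¬py e)
      ... | no ¬px | yes py = ⊥-elim (positive≠nonpositive py ¬px (sym e))

      square : ∃[ x ] θ x ≈ m′ → IsSquare (m * m′)
      square (x , θx≈m′) with positive? x
      ... | yes _ = ⊥-elim (¬□m′ (x , θx≈m′))
      ... | no _ = m * x , trans (solve 2 (λ m x → (m :* x) :* (m :* x) := m :* (m :* (x :* x))) refl m x) (*-congˡ θx≈m′)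

    -- If every element were a square, the square root normalised to be
    -- nonnegative would be injective, hence onto, yet it misses the negatives.
    nonSquare-exists : ∃[ m ] ¬ IsSquare m
    nonSquare-exists with search (¬_ ∘ IsSquare) (λ x → ¬? (isSquare? x)) (λ x≈y ¬□x □y → ¬□x (isSquare-resp (sym x≈y) □y))
    ... | yes found = found
    ... | no none = ⊥-elim (not-onto (injective⇒surjective √ √-injective (proj₁ negative)))
      where
      root : Carrier → Carrier
      root y with isSquare? y
      ... | yes (r , _) = r
      ... | no ¬□y = ⊥-elim (none (y , ¬□y))

      root² : ∀ y → root y * root y ≈ y
      root² y with isSquare? y
      ... | yes (_ , rr≈y) = rr≈y
      ... | no ¬□y = ⊥-elim (none (y , ¬□y))

      √ : Carrier → Carrier
      √ y with positive? (root y)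
      ... | yes _ = root y
      ... | no _ = - root y

      √² : ∀ y → √ y * √ y ≈ y
      √² y with positive? (root y)
      ... | yes _ = root² y
      ... | no _ = trans (solve 1 (λ r → (:- r) :* (:- r) := r :* r) refl (root y)) (root² y)

      √-injective : ∀ {x y} → √ x ≈ √ y → x ≈ y
      √-injective {x} {y} e = trans (sym (√² x)) (trans (*-cong e e) (√² y))

      √-nonnegative : ∀ y → ¬ Positive (- √ y)
      √-nonnegative y with positive? (root y)
      ... | yes p = ¬positive-both (root y) p
      ... | no ¬p = ¬p ∘ positive-resp (-‿involutive (root y))

      negative : ∃[ s ] Positive (- s)
      negative with positive-or-negated (- 1#) -1≉0
      ... | inj₁ p = 1# , p
      ... | inj₂ p = - 1# , p

      not-onto : ∃[ y ] √ y ≈ proj₁ negative → ⊥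
      not-onto (y , e) = √-nonnegative y (positive-resp (-‿cong (sym e)) (proj₂ negative))

module Coordinates (F : FiniteField) where
  open FiniteField F hiding (zero)
  open Geometry F
  open FieldLemmas F
  open import Relation.Binary.Reasoning.Setoid setoid
  open IntegerRingSolver commRing using (solve; _:=_; Polynomial; con; _:+_; _:*_; :-_)

  Mat : Set
  Mat = Fin 4 → Fin 4 → Carrier

  -- A acting on plane coordinates, dual to the action v ↦ v · A on points.
  _▷_ : Mat → V4 → V4
  (A ▷ π) i = A i 0F * π 0F + A i 1F * π 1F
            + A i 2F * π 2F
            + A i 3F * π 3F

  unit : Fin 4 → V4
  unit 0F = vec 1# 0# 0# 0#
  unit 1F = vec 0# 1# 0# 0#
  unit 2F = vec 0# 0# 1# 0#
  unit 3F = vec 0# 0# 0# 1#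

  -- Mirrors of the coordinate operations on solver expressions: their
  -- semantics unfold to exactly the terms built by vec, _·_, _▷_ and dot.
  module _ {n : ℕ} where
    private X = Polynomial n

    vecₑ : X → X → X → X → Fin 4 → X
    vecₑ a b c d 0F = a
    vecₑ a b c d 1F = b
    vecₑ a b c d 2F = c
    vecₑ a b c d 3F = d

    dotₑ : (Fin 4 → X) → (Fin 4 → X) → X
    dotₑ π v = π 0F :* v 0F :+ π 1F :* v 1F
             :+ π 2F :* v 2F
             :+ π 3F :* v 3F

    _·ₑ_ : (Fin 4 → X) → (Fin 4 → Fin 4 → X) → Fin 4 → X
    (v ·ₑ A) j = v 0F :* A 0F j :+ v 1F :* A 1F j
               :+ v 2F :* A 2F j
               :+ v 3F :* A 3F j

    _▷ₑ_ : (Fin 4 → Fin 4 → X) → (Fin 4 → X) → Fin 4 → X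
    (A ▷ₑ π) i = A i 0F :* π 0F :+ A i 1F :* π 1F
               :+ A i 2F :* π 2F
               :+ A i 3F :* π 3F

    Mₑ : X → X → X → X → Fin 4 → Fin 4 → X
    Mₑ a b c d 0F = vecₑ (a :* a :* a) (a :* a :* b) (a :* b :* b) (b :* b :* b)
    Mₑ a b c d 1F = vecₑ (con (+ 3) :* (a :* a :* c)) (a :* a :* d :+ con (+ 2) :* (a :* b :* c))
                                 (b :* b :* c :+ con (+ 2) :* (a :* b :* d)) (con (+ 3) :* (b :* b :* d))
    Mₑ a b c d 2F = vecₑ (con (+ 3) :* (a :* c :* c)) (b :* c :* c :+ con (+ 2) :* (a :* c :* d))
                                       (a :* d :* d :+ con (+ 2) :* (b :* c :* d)) (con (+ 3) :* (b :* d :* d))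
    Mₑ a b c d 3F = vecₑ (c :* c :* c) (c :* c :* d) (c :* d :* d) (d :* d :* d)

  dot-unit : ∀ j w → dot (unit j) w ≈ w j
  dot-unit 0F w = solve 4 (λ a b c d → dotₑ (vecₑ (con (+ 1)) (con (+ 0)) (con (+ 0)) (con (+ 0))) (vecₑ a b c d) := a) refl _ _ _ _
  dot-unit 1F w = solve 4 (λ a b c d → dotₑ (vecₑ (con (+ 0)) (con (+ 1)) (con (+ 0)) (con (+ 0))) (vecₑ a b c d) := b) refl _ _ _ _
  dot-unit 2F w = solve 4 (λ a b c d → dotₑ (vecₑ (con (+ 0)) (con (+ 0)) (con (+ 1)) (con (+ 0))) (vecₑ a b c d) := c) refl _ _ _ _
  dot-unit 3F w = solve 4 (λ a b c d → dotₑ (vecₑ (con (+ 0)) (con (+ 0)) (con (+ 0)) (con (+ 1))) (vecₑ a b c d) := d) refl _ _ _ _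

  -- A vector identity is proved as one scalar identity against a generic
  -- plane ρ, which the solver handles in a single call.
  ≈-by-dot : ∀ {u v} → (∀ ρ → dot ρ u ≈ dot ρ v) → ∀ j → u j ≈ v j
  ≈-by-dot {u} {v} e j = trans (sym (dot-unit j u)) (trans (e (unit j)) (dot-unit j v))

  dot-· : ∀ (A : Mat) π v → dot π (v · A) ≈ dot (A ▷ π) v
  dot-· A π v = solve 24 (λ a₀₀ a₀₁ a₀₂ a₀₃ a₁₀ a₁₁ a₁₂ a₁₃ a₂₀ a₂₁ a₂₂ a₂₃ a₃₀ a₃₁ a₃₂ a₃₃ p₀ p₁ p₂ p₃ v₀ v₁ v₂ v₃ →
      let Aₑ = λ { 0F → vecₑ a₀₀ a₀₁ a₀₂ a₀₃ ; 1F → vecₑ a₁₀ a₁₁ a₁₂ a₁₃ ; 2F → vecₑ a₂₀ a₂₁ a₂₂ a₂₃ ; 3F → vecₑ a₃₀ a₃₁ a₃₂ a₃₃ }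
      in dotₑ (vecₑ p₀ p₁ p₂ p₃) (vecₑ v₀ v₁ v₂ v₃ ·ₑ Aₑ) := dotₑ (Aₑ ▷ₑ vecₑ p₀ p₁ p₂ p₃) (vecₑ v₀ v₁ v₂ v₃))
    refl (A 0F 0F) (A 0F 1F) (A 0F 2F) (A 0F 3F) (A 1F 0F) (A 1F 1F) (A 1F 2F) (A 1F 3F)
         (A 2F 0F) (A 2F 1F) (A 2F 2F) (A 2F 3F) (A 3F 0F) (A 3F 1F) (A 3F 2F) (A 3F 3F)
         (π 0F) (π 1F) (π 2F) (π 3F) (v 0F) (v 1F) (v 2F) (v 3F)

  ·-linear : ∀ (A : Mat) a b u v j → ((λ i → a * u i + b * v i) · A) j ≈ a * (u · A) j + b * (v · A) j
  ·-linear A a b u v j = solve 14 (λ a b u₀ u₁ u₂ u₃ v₀ v₁ v₂ v₃ c₀ c₁ c₂ c₃ →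
      (a :* u₀ :+ b :* v₀) :* c₀ :+ (a :* u₁ :+ b :* v₁) :* c₁ :+ (a :* u₂ :+ b :* v₂) :* c₂ :+ (a :* u₃ :+ b :* v₃) :* c₃
    := a :* (u₀ :* c₀ :+ u₁ :* c₁ :+ u₂ :* c₂ :+ u₃ :* c₃) :+ b :* (v₀ :* c₀ :+ v₁ :* c₁ :+ v₂ :* c₂ :+ v₃ :* c₃))
    refl a b (u 0F) (u 1F) (u 2F) (u 3F) (v 0F) (v 1F) (v 2F) (v 3F) (A 0F j) (A 1F j) (A 2F j) (A 3F j)

  ·-scale : ∀ (A : Mat) a u j → ((λ i → a * u i) · A) j ≈ a * (u · A) j
  ·-scale A a u j = solve 9 (λ a u₀ u₁ u₂ u₃ c₀ c₁ c₂ c₃ →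
      (a :* u₀) :* c₀ :+ (a :* u₁) :* c₁ :+ (a :* u₂) :* c₂ :+ (a :* u₃) :* c₃ := a :* (u₀ :* c₀ :+ u₁ :* c₁ :+ u₂ :* c₂ :+ u₃ :* c₃))
    refl a (u 0F) (u 1F) (u 2F) (u 3F) (A 0F j) (A 1F j) (A 2F j) (A 3F j)

  ▷-scale : ∀ (A : Mat) a π i → (A ▷ (λ j → a * π j)) i ≈ a * (A ▷ π) i
  ▷-scale A a π i = solve 9 (λ a p₀ p₁ p₂ p₃ c₀ c₁ c₂ c₃ →
      c₀ :* (a :* p₀) :+ c₁ :* (a :* p₁) :+ c₂ :* (a :* p₂) :+ c₃ :* (a :* p₃) := a :* (c₀ :* p₀ :+ c₁ :* p₁ :+ c₂ :* p₂ :+ c₃ :* p₃))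
    refl a (π 0F) (π 1F) (π 2F) (π 3F) (A i 0F) (A i 1F) (A i 2F) (A i 3F)

  dot-linear : ∀ π a b u v → dot π (λ i → a * u i + b * v i) ≈ a * dot π u + b * dot π v
  dot-linear π a b u v = solve 14 (λ a b u₀ u₁ u₂ u₃ v₀ v₁ v₂ v₃ p₀ p₁ p₂ p₃ →
      dotₑ (vecₑ p₀ p₁ p₂ p₃) (λ i → a :* vecₑ u₀ u₁ u₂ u₃ i :+ b :* vecₑ v₀ v₁ v₂ v₃ i)
    := a :* dotₑ (vecₑ p₀ p₁ p₂ p₃) (vecₑ u₀ u₁ u₂ u₃) :+ b :* dotₑ (vecₑ p₀ p₁ p₂ p₃) (vecₑ v₀ v₁ v₂ v₃))
    refl a b (u 0F) (u 1F) (u 2F) (u 3F) (v 0F) (v 1F) (v 2F) (v 3F) (π 0F) (π 1F) (π 2F) (π 3F)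

  dot-scaleʳ : ∀ π a u → dot π (λ i → a * u i) ≈ a * dot π u
  dot-scaleʳ π a u = solve 9 (λ a u₀ u₁ u₂ u₃ p₀ p₁ p₂ p₃ →
      dotₑ (vecₑ p₀ p₁ p₂ p₃) (λ i → a :* vecₑ u₀ u₁ u₂ u₃ i) := a :* dotₑ (vecₑ p₀ p₁ p₂ p₃) (vecₑ u₀ u₁ u₂ u₃))
    refl a (u 0F) (u 1F) (u 2F) (u 3F) (π 0F) (π 1F) (π 2F) (π 3F)

  dot-scaleˡ : ∀ π a u → dot (λ i → a * π i) u ≈ a * dot π u
  dot-scaleˡ π a u = solve 9 (λ a u₀ u₁ u₂ u₃ p₀ p₁ p₂ p₃ →
      dotₑ (λ i → a :* vecₑ p₀ p₁ p₂ p₃ i) (vecₑ u₀ u₁ u₂ u₃) := a :* dotₑ (vecₑ p₀ p₁ p₂ p₃) (vecₑ u₀ u₁ u₂ u₃))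
    refl a (u 0F) (u 1F) (u 2F) (u 3F) (π 0F) (π 1F) (π 2F) (π 3F)

  dot-cong : ∀ {π π′ u u′} → (∀ i → π i ≈ π′ i) → (∀ i → u i ≈ u′ i) → dot π u ≈ dot π′ u′
  dot-cong p q = +-cong (+-cong (+-cong (*-cong (p _) (q _)) (*-cong (p _) (q _))) (*-cong (p _) (q _))) (*-cong (p _) (q _))

  ·-cong : ∀ {u u′} (A : Mat) → (∀ i → u i ≈ u′ i) → ∀ j → (u · A) j ≈ (u′ · A) j
  ·-cong A q j = +-cong (+-cong (+-cong (*-congʳ (q _)) (*-congʳ (q _))) (*-congʳ (q _))) (*-congʳ (q _))

  ▷-cong : ∀ {π π′} (A : Mat) → (∀ i → π i ≈ π′ i) → ∀ j → (A ▷ π) j ≈ (A ▷ π′) j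
  ▷-cong A q j = +-cong (+-cong (+-cong (*-congˡ (q _)) (*-congˡ (q _))) (*-congˡ (q _))) (*-congˡ (q _))

  ·-0F : ∀ (A : Mat) j → ((λ _ → 0#) · A) j ≈ 0#
  ·-0F A j = solve 4 (λ a b c d → con (+ 0) :* a :+ con (+ 0) :* b :+ con (+ 0) :* c :+ con (+ 0) :* d := con (+ 0))
    refl (A 0F j) (A 1F j) (A 2F j) (A 3F j)

  ▷-0F : ∀ (A : Mat) i → (A ▷ (λ _ → 0#)) i ≈ 0#
  ▷-0F A i = solve 4 (λ a b c d → a :* con (+ 0) :+ b :* con (+ 0) :+ c :* con (+ 0) :+ d :* con (+ 0) := con (+ 0))
    refl (A i 0F) (A i 1F) (A i 2F) (A i 3F)

  infix 4 _∝_
  _∝_ : V4 → V4 → Set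
  _∝_ = Proportional

  ≈⇒∝ : ∀ {u v} → (∀ j → u j ≈ v j) → u ∝ v
  ≈⇒∝ e = 1# , 1≉0 , λ j → trans (e j) (sym (*-identityˡ _))

  ∝-sym : ∀ {u v} → u ∝ v → v ∝ u
  ∝-sym {u} {v} (c , c≉0 , e) = c⁻¹ , c⁻¹≉0 , λ i → begin
      v i            ≈⟨ sym (*-identityˡ _) ⟩
      1# * v i       ≈⟨ *-congʳ (sym (trans (*-comm c⁻¹ c) (*-recip c c≉0))) ⟩
      (c⁻¹ * c) * v i ≈⟨ *-assoc _ _ _ ⟩
      c⁻¹ * (c * v i) ≈⟨ *-congˡ (sym (e i)) ⟩
      c⁻¹ * u i      ∎
    where
    c⁻¹ = recip c c≉0
    c⁻¹≉0 : c⁻¹ ≉ 0#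
    c⁻¹≉0 c⁻¹≈0 = 1≉0 (trans (sym (*-recip c c≉0)) (trans (*-congˡ c⁻¹≈0) (zeroʳ c)))

  ∝-trans : ∀ {u v w} → u ∝ v → v ∝ w → u ∝ w
  ∝-trans (c , c≉0 , e) (d , d≉0 , f) = c * d , *-≉0 c≉0 d≉0 , λ i → trans (e i) (trans (*-congˡ (f i)) (sym (*-assoc _ _ _)))

  ∝-· : ∀ {u v} (A : Mat) → u ∝ v → (u · A) ∝ (v · A)
  ∝-· {v = v} A (c , c≉0 , e) = c , c≉0 , λ j → trans (·-cong A e j) (·-scale A c v j)

  ∝-▷ : ∀ {π ρ} (A : Mat) → π ∝ ρ → (A ▷ π) ∝ (A ▷ ρ)
  ∝-▷ {ρ = ρ} A (c , c≉0 , e) = c , c≉0 , λ j → trans (▷-cong A e j) (▷-scale A c ρ j)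

  onPlane-∝ : ∀ {w v π} → w ∝ v → OnPlane v π → OnPlane w π
  onPlane-∝ {w} {v} {π} (c , _ , e) o = begin
    dot π w                ≈⟨ dot-cong {π} (λ _ → refl) e ⟩
    dot π (λ i → c * v i)  ≈⟨ dot-scaleʳ π c v ⟩
    c * dot π v            ≈⟨ trans (*-congˡ o) (zeroʳ c) ⟩
    0#                     ∎

  onPlane-∝ᵖ : ∀ {v π ρ} → π ∝ ρ → OnPlane v ρ → OnPlane v π
  onPlane-∝ᵖ {v} {π} {ρ} (c , _ , e) o = begin
    dot π v                ≈⟨ dot-cong {u = v} e (λ _ → refl) ⟩
    dot (λ i → c * ρ i) v  ≈⟨ dot-scaleˡ ρ c v ⟩
    c * dot ρ v            ≈⟨ trans (*-congˡ o) (zeroʳ c) ⟩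
    0#                     ∎

  lineInPlane-∝ : ∀ {ℓ π ρ} → π ∝ ρ → LineInPlane ℓ ρ → LineInPlane ℓ π
  lineInPlane-∝ {ℓ} p (o₁ , o₂) = onPlane-∝ᵖ {p₁ ℓ} p o₁ , onPlane-∝ᵖ {p₂ ℓ} p o₂

  inSpan-left : ∀ u v → InSpan u u v
  inSpan-left u v = 1# , 0# , λ i → solve 2 (λ u v → u := con (+ 1) :* u :+ con (+ 0) :* v) refl (u i) (v i)

  inSpan-right : ∀ u v → InSpan v u v
  inSpan-right u v = 0# , 1# , λ i → solve 2 (λ u v → v := con (+ 0) :* u :+ con (+ 1) :* v) refl (u i) (v i)

  inSpan-trans : ∀ {w u v x y} → InSpan w u v → InSpan u x y → InSpan v x y → InSpan w x y
  inSpan-trans {w} {u} {v} {x} {y} (a , b , e) (a₁ , b₁ , e₁) (a₂ , b₂ , e₂) =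
    a * a₁ + b * a₂ , a * b₁ + b * b₂ , λ i → begin
      w i                                                ≈⟨ e i ⟩
      a * u i + b * v i                                  ≈⟨ +-cong (*-congˡ (e₁ i)) (*-congˡ (e₂ i)) ⟩
      a * (a₁ * x i + b₁ * y i) + b * (a₂ * x i + b₂ * y i)
        ≈⟨ solve 8 (λ a b a₁ b₁ a₂ b₂ x y → a :* (a₁ :* x :+ b₁ :* y) :+ b :* (a₂ :* x :+ b₂ :* y)
                                        := (a :* a₁ :+ b :* a₂) :* x :+ (a :* b₁ :+ b :* b₂) :* y)
             refl a b a₁ b₁ a₂ b₂ (x i) (y i) ⟩
      (a * a₁ + b * a₂) * x i + (a * b₁ + b * b₂) * y i  ∎

  inSpan-rescale : ∀ {w x y x′ y′} c → (∀ i → x i ≈ c * x′ i) → (∀ i → y i ≈ c * y′ i) → InSpan w x y → InSpan w x′ y′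
  inSpan-rescale {w} {x} {y} {x′} {y′} c ex ey (a , b , e) = a * c , b * c , λ i → begin
    w i                              ≈⟨ e i ⟩
    a * x i + b * y i                ≈⟨ +-cong (*-congˡ (ex i)) (*-congˡ (ey i)) ⟩
    a * (c * x′ i) + b * (c * y′ i)  ≈⟨ solve 5 (λ a b c x y → a :* (c :* x) :+ b :* (c :* y) := a :* c :* x :+ b :* c :* y) refl a b c (x′ i) (y′ i) ⟩
    a * c * x′ i + b * c * y′ i      ∎

  inSpan-∝ : ∀ {w w′ u v} → w ∝ w′ → InSpan w′ u v → InSpan w u v
  inSpan-∝ {w} {w′} {u} {v} (c , _ , e) (a , b , f) = c * a , c * b , λ i → begin
    w i                          ≈⟨ e i ⟩
    c * w′ i                     ≈⟨ *-congˡ (f i) ⟩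
    c * (a * u i + b * v i)      ≈⟨ solve 5 (λ c a b u v → c :* (a :* u :+ b :* v) := c :* a :* u :+ c :* b :* v) refl c a b (u i) (v i) ⟩
    c * a * u i + c * b * v i    ∎

  inSpan-· : ∀ {w u v} (A : Mat) → InSpan w u v → InSpan (w · A) (u · A) (v · A)
  inSpan-· {u = u} {v} A (a , b , e) = a , b , λ j → trans (·-cong A e j) (·-linear A a b u v j)

  onPlane-inSpan : ∀ {w u v π} → InSpan w u v → OnPlane u π → OnPlane v π → OnPlane w π
  onPlane-inSpan {w} {u} {v} {π} (a , b , e) ou ov = begin
    dot π w                          ≈⟨ dot-cong {π} (λ _ → refl) e ⟩
    dot π (λ i → a * u i + b * v i)  ≈⟨ dot-linear π a b u v ⟩
    a * dot π u + b * dot π v        ≈⟨ +-cong (trans (*-congˡ ou) (zeroʳ a)) (trans (*-congˡ ov) (zeroʳ b)) ⟩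
    0# + 0#                          ≈⟨ +-identityʳ _ ⟩
    0#                               ∎

  spannedBy-trans : ∀ {ℓ e f x y} → SpannedBy ℓ e f → InSpan e x y → InSpan f x y → InSpan x e f → InSpan y e f → SpannedBy ℓ x y
  spannedBy-trans ((ℓ₁∈ , ℓ₂∈) , (e∈ , f∈)) e∈xy f∈xy x∈ef y∈ef =
    (inSpan-trans ℓ₁∈ e∈xy f∈xy , inSpan-trans ℓ₂∈ e∈xy f∈xy) ,
    (inSpan-trans x∈ef e∈ f∈ , inSpan-trans y∈ef e∈ f∈)

  lineInPlane-spannedBy : ∀ {ℓ e f π} → SpannedBy ℓ e f → OnPlane e π → OnPlane f π → LineInPlane ℓ π
  lineInPlane-spannedBy {π = π} ((ℓ₁∈ , ℓ₂∈) , _) oe of = onPlane-inSpan {π = π} ℓ₁∈ oe of , onPlane-inSpan {π = π} ℓ₂∈ oe of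

module TwistedCubic (F : FiniteField) where
  open FiniteField F hiding (zero; inverse)
  open Geometry F
  open FieldLemmas F
  open Coordinates F
  open IntegerRingSolver commRing using (solve; _:=_; Polynomial; con; _:+_; _:*_; :-_)
  open import Relation.Binary.Reasoning.Setoid setoid

  M⁻ : Carrier → Carrier → Carrier → Carrier → Mat
  M⁻ a b c d = M d (- b) (- c) a

  det : Carrier → Carrier → Carrier → Carrier → Carrier
  det a b c d = a * d + - (b * c)

  -- The point of C with homogeneous parameter (A : B), and the osculating
  -- plane at the parameter (- q : p): P (fin t) = V 1# t, Π (fin t) ∝ W (- t) 1#.
  V : Carrier → Carrier → V4
  V A B = vec (A * A * A) (A * A * B) (A * B * B) (B * B * B)

  W : Carrier → Carrier → V4
  W p q = vec (p * p * p) (3# * (p * p * q)) (3# * (p * q * q)) (q * q * q)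

  module _ {n : ℕ} where
    private X = Polynomial n

    Vₑ Wₑ : X → X → Fin 4 → X
    Vₑ A B = vecₑ (A :* A :* A) (A :* A :* B) (A :* B :* B) (B :* B :* B)
    Wₑ p q = vecₑ (p :* p :* p) (con (+ 3) :* (p :* p :* q)) (con (+ 3) :* (p :* q :* q)) (q :* q :* q)

    Pₑ Πₑ : X → Fin 4 → X
    Pₑ t = vecₑ (con (+ 1)) t (t :* t) (t :* t :* t)
    Πₑ t = vecₑ (:- (t :* t :* t)) (con (+ 3) :* (t :* t)) (:- (con (+ 3) :* t)) (con (+ 1))

    detₑ : X → X → X → X → X
    detₑ a b c d = a :* d :+ :- (b :* c)

    cubeₑ : X → X
    cubeₑ x = x :* x :* x

  M-M⁻ : ∀ a b c d v j → ((v · M a b c d) · M⁻ a b c d) j ≈ cube (det a b c d) * v j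
  M-M⁻ a b c d v = ≈-by-dot λ ρ → solve 12 (λ a b c d v₀ v₁ v₂ v₃ ρ₀ ρ₁ ρ₂ ρ₃ →
      dotₑ (vecₑ ρ₀ ρ₁ ρ₂ ρ₃) ((vecₑ v₀ v₁ v₂ v₃ ·ₑ Mₑ a b c d) ·ₑ Mₑ d (:- b) (:- c) a)
    := dotₑ (vecₑ ρ₀ ρ₁ ρ₂ ρ₃) (λ j → cubeₑ (detₑ a b c d) :* vecₑ v₀ v₁ v₂ v₃ j))
    refl a b c d (v 0F) (v 1F) (v 2F) (v 3F) (ρ 0F) (ρ 1F) (ρ 2F) (ρ 3F)

  M⁻-M : ∀ a b c d v j → ((v · M⁻ a b c d) · M a b c d) j ≈ cube (det a b c d) * v j
  M⁻-M a b c d v = ≈-by-dot λ ρ → solve 12 (λ a b c d v₀ v₁ v₂ v₃ ρ₀ ρ₁ ρ₂ ρ₃ →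
      dotₑ (vecₑ ρ₀ ρ₁ ρ₂ ρ₃) ((vecₑ v₀ v₁ v₂ v₃ ·ₑ Mₑ d (:- b) (:- c) a) ·ₑ Mₑ a b c d)
    := dotₑ (vecₑ ρ₀ ρ₁ ρ₂ ρ₃) (λ j → cubeₑ (detₑ a b c d) :* vecₑ v₀ v₁ v₂ v₃ j))
    refl a b c d (v 0F) (v 1F) (v 2F) (v 3F) (ρ 0F) (ρ 1F) (ρ 2F) (ρ 3F)

  M▷M⁻▷ : ∀ a b c d π i → (M a b c d ▷ (M⁻ a b c d ▷ π)) i ≈ cube (det a b c d) * π i
  M▷M⁻▷ a b c d π = ≈-by-dot λ ρ → solve 12 (λ a b c d π₀ π₁ π₂ π₃ ρ₀ ρ₁ ρ₂ ρ₃ →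
      dotₑ (vecₑ ρ₀ ρ₁ ρ₂ ρ₃) (Mₑ a b c d ▷ₑ (Mₑ d (:- b) (:- c) a ▷ₑ vecₑ π₀ π₁ π₂ π₃))
    := dotₑ (vecₑ ρ₀ ρ₁ ρ₂ ρ₃) (λ j → cubeₑ (detₑ a b c d) :* vecₑ π₀ π₁ π₂ π₃ j))
    refl a b c d (π 0F) (π 1F) (π 2F) (π 3F) (ρ 0F) (ρ 1F) (ρ 2F) (ρ 3F)

  M⁻▷M▷ : ∀ a b c d π i → (M⁻ a b c d ▷ (M a b c d ▷ π)) i ≈ cube (det a b c d) * π i
  M⁻▷M▷ a b c d π = ≈-by-dot λ ρ → solve 12 (λ a b c d π₀ π₁ π₂ π₃ ρ₀ ρ₁ ρ₂ ρ₃ →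
      dotₑ (vecₑ ρ₀ ρ₁ ρ₂ ρ₃) (Mₑ d (:- b) (:- c) a ▷ₑ (Mₑ a b c d ▷ₑ vecₑ π₀ π₁ π₂ π₃))
    := dotₑ (vecₑ ρ₀ ρ₁ ρ₂ ρ₃) (λ j → cubeₑ (detₑ a b c d) :* vecₑ π₀ π₁ π₂ π₃ j))
    refl a b c d (π 0F) (π 1F) (π 2F) (π 3F) (ρ 0F) (ρ 1F) (ρ 2F) (ρ 3F)

  M-· : ∀ a b c d e f g h v j →
        ((v · M a b c d) · M e f g h) j ≈ (v · M (a * e + b * g) (a * f + b * h) (c * e + d * g) (c * f + d * h)) j
  M-· a b c d e f g h v = ≈-by-dot λ ρ → solve 16 (λ a b c d e f g h v₀ v₁ v₂ v₃ ρ₀ ρ₁ ρ₂ ρ₃ →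
      dotₑ (vecₑ ρ₀ ρ₁ ρ₂ ρ₃) ((vecₑ v₀ v₁ v₂ v₃ ·ₑ Mₑ a b c d) ·ₑ Mₑ e f g h)
    := dotₑ (vecₑ ρ₀ ρ₁ ρ₂ ρ₃) (vecₑ v₀ v₁ v₂ v₃ ·ₑ Mₑ (a :* e :+ b :* g) (a :* f :+ b :* h) (c :* e :+ d :* g) (c :* f :+ d :* h)))
    refl a b c d e f g h (v 0F) (v 1F) (v 2F) (v 3F) (ρ 0F) (ρ 1F) (ρ 2F) (ρ 3F)

  det-· : ∀ a b c d e f g h → det (a * e + b * g) (a * f + b * h) (c * e + d * g) (c * f + d * h) ≈ det a b c d * det e f g h
  det-· = solve 8 (λ a b c d e f g h → detₑ (a :* e :+ b :* g) (a :* f :+ b :* h) (c :* e :+ d :* g) (c :* f :+ d :* h) := detₑ a b c d :* detₑ e f g h) refl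

  det-M⁻ : ∀ a b c d → det d (- b) (- c) a ≈ det a b c d
  det-M⁻ = solve 4 (λ a b c d → detₑ d (:- b) (:- c) a := detₑ a b c d) refl

  V-· : ∀ a b c d A B j → (V A B · M a b c d) j ≈ V (a * A + c * B) (b * A + d * B) j
  V-· a b c d A B = ≈-by-dot λ ρ → solve 10 (λ a b c d A B ρ₀ ρ₁ ρ₂ ρ₃ →
      dotₑ (vecₑ ρ₀ ρ₁ ρ₂ ρ₃) (Vₑ A B ·ₑ Mₑ a b c d) := dotₑ (vecₑ ρ₀ ρ₁ ρ₂ ρ₃) (Vₑ (a :* A :+ c :* B) (b :* A :+ d :* B)))
    refl a b c d A B (ρ 0F) (ρ 1F) (ρ 2F) (ρ 3F)

  ▷-W : ∀ a b c d p q j → (M a b c d ▷ W p q) j ≈ W (a * p + b * q) (c * p + d * q) j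
  ▷-W a b c d p q = ≈-by-dot λ ρ → solve 10 (λ a b c d p q ρ₀ ρ₁ ρ₂ ρ₃ →
      dotₑ (vecₑ ρ₀ ρ₁ ρ₂ ρ₃) (Mₑ a b c d ▷ₑ Wₑ p q) := dotₑ (vecₑ ρ₀ ρ₁ ρ₂ ρ₃) (Wₑ (a :* p :+ b :* q) (c :* p :+ d :* q)))
    refl a b c d p q (ρ 0F) (ρ 1F) (ρ 2F) (ρ 3F)

  dot-W-V : ∀ p q A B → dot (W p q) (V A B) ≈ cube (p * A + q * B)
  dot-W-V = solve 4 (λ p q A B → dotₑ (Wₑ p q) (Vₑ A B) := cubeₑ (p :* A :+ q :* B)) refl

  NotBothZero : Carrier → Carrier → Set
  NotBothZero A B = ¬ (A ≈ 0# × B ≈ 0#)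

  P-fin≈V : ∀ t j → P (fin t) j ≈ V 1# t j
  P-fin≈V t = ≈-by-dot λ ρ → solve 5 (λ t ρ₀ ρ₁ ρ₂ ρ₃ →
      dotₑ (vecₑ ρ₀ ρ₁ ρ₂ ρ₃) (Pₑ t) := dotₑ (vecₑ ρ₀ ρ₁ ρ₂ ρ₃) (Vₑ (con (+ 1)) t))
    refl t (ρ 0F) (ρ 1F) (ρ 2F) (ρ 3F)

  P-∞≈V : ∀ j → P ∞ j ≈ V 0# 1# j
  P-∞≈V = ≈-by-dot λ ρ → solve 4 (λ ρ₀ ρ₁ ρ₂ ρ₃ →
      dotₑ (vecₑ ρ₀ ρ₁ ρ₂ ρ₃) (vecₑ (con (+ 0)) (con (+ 0)) (con (+ 0)) (con (+ 1))) := dotₑ (vecₑ ρ₀ ρ₁ ρ₂ ρ₃) (Vₑ (con (+ 0)) (con (+ 1))))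
    refl (ρ 0F) (ρ 1F) (ρ 2F) (ρ 3F)

  Π-fin≈W : ∀ t j → Π (fin t) j ≈ W (- t) 1# j
  Π-fin≈W t = ≈-by-dot λ ρ → solve 5 (λ t ρ₀ ρ₁ ρ₂ ρ₃ →
      dotₑ (vecₑ ρ₀ ρ₁ ρ₂ ρ₃) (Πₑ t)
    := dotₑ (vecₑ ρ₀ ρ₁ ρ₂ ρ₃) (Wₑ (:- t) (con (+ 1))))
    refl t (ρ 0F) (ρ 1F) (ρ 2F) (ρ 3F)

  Π-∞≈W : ∀ j → Π ∞ j ≈ W 1# 0# j
  Π-∞≈W = ≈-by-dot λ ρ → solve 4 (λ ρ₀ ρ₁ ρ₂ ρ₃ →
      dotₑ (vecₑ ρ₀ ρ₁ ρ₂ ρ₃) (vecₑ (con (+ 1)) (con (+ 0)) (con (+ 0)) (con (+ 0))) := dotₑ (vecₑ ρ₀ ρ₁ ρ₂ ρ₃) (Wₑ (con (+ 1)) (con (+ 0))))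
    refl (ρ 0F) (ρ 1F) (ρ 2F) (ρ 3F)

  P≈V : ∀ u → ∃[ A ] ∃[ B ] NotBothZero A B × (∀ j → P u j ≈ V A B j)
  P≈V (fin t) = 1# , t , (λ z → 1≉0 (proj₁ z)) , P-fin≈V t
  P≈V ∞ = 0# , 1# , (λ z → 1≉0 (proj₂ z)) , P-∞≈V

  Π≈W : ∀ u → ∃[ p ] ∃[ q ] NotBothZero p q × (∀ j → Π u j ≈ W p q j)
  Π≈W (fin t) = - t , 1# , (λ z → 1≉0 (proj₂ z)) , Π-fin≈W t
  Π≈W ∞ = 1# , 0# , (λ z → 1≉0 (proj₁ z)) , Π-∞≈W

  V-homogeneous : ∀ k A B j → V (k * A) (k * B) j ≈ cube k * V A B j
  V-homogeneous k A B = ≈-by-dot λ ρ → solve 7 (λ k A B ρ₀ ρ₁ ρ₂ ρ₃ →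
      dotₑ (vecₑ ρ₀ ρ₁ ρ₂ ρ₃) (Vₑ (k :* A) (k :* B)) := dotₑ (vecₑ ρ₀ ρ₁ ρ₂ ρ₃) (λ j → cubeₑ k :* Vₑ A B j))
    refl k A B (ρ 0F) (ρ 1F) (ρ 2F) (ρ 3F)

  W-homogeneous : ∀ k p q j → W (k * p) (k * q) j ≈ cube k * W p q j
  W-homogeneous k p q = ≈-by-dot λ ρ → solve 7 (λ k p q ρ₀ ρ₁ ρ₂ ρ₃ →
      dotₑ (vecₑ ρ₀ ρ₁ ρ₂ ρ₃) (Wₑ (k :* p) (k :* q)) := dotₑ (vecₑ ρ₀ ρ₁ ρ₂ ρ₃) (λ j → cubeₑ k :* Wₑ p q j))
    refl k p q (ρ 0F) (ρ 1F) (ρ 2F) (ρ 3F)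

  V-cong : ∀ {A A′ B B′} → A ≈ A′ → B ≈ B′ → ∀ j → V A B j ≈ V A′ B′ j
  V-cong eA eB 0F = *-cong (*-cong eA eA) eA
  V-cong eA eB 1F = *-cong (*-cong eA eA) eB
  V-cong eA eB 2F = *-cong (*-cong eA eB) eB
  V-cong eA eB 3F = *-cong (*-cong eB eB) eB

  W-cong : ∀ {p p′ q q′} → p ≈ p′ → q ≈ q′ → ∀ j → W p q j ≈ W p′ q′ j
  W-cong ep eq 0F = *-cong (*-cong ep ep) ep
  W-cong ep eq 1F = *-congˡ (*-cong (*-cong ep ep) eq)
  W-cong ep eq 2F = *-congˡ (*-cong (*-cong ep eq) eq)
  W-cong ep eq 3F = *-cong (*-cong eq eq) eq

  private
    divide-back : ∀ k (k≉0 : k ≉ 0#) x → k * (x * recip k k≉0) ≈ x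
    divide-back k k≉0 x = ≈-modulo (k * recip k k≉0 + - 1#) x
      (solve 3 (λ k x i → k :* (x :* i) := x :+ x :* (k :* i :+ :- con (+ 1))) refl k x (recip k k≉0)) (x≈y⇒x-y≈0 (*-recip k k≉0))

  V-rescale : ∀ {A B} k (k≉0 : k ≉ 0#) → V A B ∝ V (A * recip k k≉0) (B * recip k k≉0)
  V-rescale k k≉0 = cube k , cube-≉0 k≉0 , λ j →
    trans (V-cong (sym (divide-back k k≉0 _)) (sym (divide-back k k≉0 _)) j) (V-homogeneous k _ _ j)

  W-rescale : ∀ {p q} k (k≉0 : k ≉ 0#) → W p q ∝ W (p * recip k k≉0) (q * recip k k≉0)
  W-rescale k k≉0 = cube k , cube-≉0 k≉0 , λ j →
    trans (W-cong (sym (divide-back k k≉0 _)) (sym (divide-back k k≉0 _)) j) (W-homogeneous k _ _ j)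

  V∝P : ∀ {A B} → NotBothZero A B → ∃[ u ] V A B ∝ P u
  V∝P {A} {B} nz with A ≟ 0#
  ... | no A≉0 = fin (B * recip A A≉0) , ∝-trans (V-rescale A A≉0) (≈⇒∝ λ j →
          trans (V-cong (*-recip A A≉0) refl j) (sym (P-fin≈V _ j)))
  ... | yes A≈0 = ∞ , ∝-trans (V-rescale B B≉0) (≈⇒∝ λ j →
          trans (V-cong (trans (*-congʳ A≈0) (zeroˡ _)) (*-recip B B≉0) j) (sym (P-∞≈V j)))
    where B≉0 : B ≉ 0#
          B≉0 B≈0 = nz (A≈0 , B≈0)

  W∝Π : ∀ {p q} → NotBothZero p q → ∃[ u ] W p q ∝ Π u
  W∝Π {p} {q} nz with q ≟ 0#
  ... | no q≉0 = fin (- (p * recip q q≉0)) , ∝-trans (W-rescale q q≉0) (≈⇒∝ λ j →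
          trans (W-cong (sym (-‿involutive _)) (*-recip q q≉0) j) (sym (Π-fin≈W _ j)))
  ... | yes q≈0 = ∞ , ∝-trans (W-rescale p p≉0) (≈⇒∝ λ j →
          trans (W-cong (*-recip p p≉0) (trans (*-congʳ q≈0) (zeroˡ _)) j) (sym (Π-∞≈W j)))
    where p≉0 : p ≉ 0#
          p≉0 p≈0 = nz (p≈0 , q≈0)

  det-transpose : ∀ a b c d → det a c b d ≈ det a b c d
  det-transpose = solve 4 (λ a b c d → detₑ a c b d := detₑ a b c d) refl

  notBothZero-linear : ∀ α β γ δ {A B} → det α β γ δ ≉ 0# → NotBothZero A B → NotBothZero (α * A + β * B) (γ * A + δ * B)
  notBothZero-linear α β γ δ {A} {B} D≉0 nz (x≈0 , y≈0) = nz (vanish A cramer-A , vanish B cramer-B)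
    where
    vanish : ∀ X → det α β γ δ * X ≈ 0# → X ≈ 0#
    vanish X e = [ ⊥-elim ∘ D≉0 , id ]′ (x*y≈0⇒x≈0⊎y≈0 e)
    cramer-A : det α β γ δ * A ≈ 0#
    cramer-A = ≈-modulo₂ (α * A + β * B) δ (γ * A + δ * B) (- β)
      (solve 6 (λ α β γ δ A B → detₑ α β γ δ :* A := con (+ 0) :+ δ :* (α :* A :+ β :* B) :+ (:- β) :* (γ :* A :+ δ :* B)) refl α β γ δ A B) x≈0 y≈0
    cramer-B : det α β γ δ * B ≈ 0#
    cramer-B = ≈-modulo₂ (α * A + β * B) (- γ) (γ * A + δ * B) α
      (solve 6 (λ α β γ δ A B → detₑ α β γ δ :* B := con (+ 0) :+ (:- γ) :* (α :* A :+ β :* B) :+ α :* (γ :* A :+ δ :* B)) refl α β γ δ A B) x≈0 y≈0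

  P·M∝P : ∀ a b c d → det a b c d ≉ 0# → ∀ u → ∃[ u′ ] (P u · M a b c d) ∝ P u′
  P·M∝P a b c d D≉0 u with P≈V u
  ... | A , B , nz , e with V∝P (notBothZero-linear a c b d (D≉0 ∘ trans (sym (det-transpose a b c d))) nz)
  ... | u′ , V∝ = u′ , ∝-trans (≈⇒∝ λ j → trans (·-cong (M a b c d) e j) (V-· a b c d A B j)) V∝

  M▷Π∝Π : ∀ a b c d → det a b c d ≉ 0# → ∀ u → ∃[ u′ ] (M a b c d ▷ Π u) ∝ Π u′
  M▷Π∝Π a b c d D≉0 u with Π≈W u
  ... | p , q , nz , e with W∝Π (notBothZero-linear a b c d D≉0 nz)
  ... | u′ , W∝ = u′ , ∝-trans (≈⇒∝ λ j → trans (▷-cong (M a b c d) e j) (▷-W a b c d p q j)) W∝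

  ≈ₚ-sym : ∀ {u v} → u ≈ₚ v → v ≈ₚ u
  ≈ₚ-sym {fin s} {fin t} e = sym e
  ≈ₚ-sym {∞} {∞} e = tt

  ≈ₚ-trans : ∀ {u v w} → u ≈ₚ v → v ≈ₚ w → u ≈ₚ w
  ≈ₚ-trans {fin s} {fin t} {fin r} e f = trans e f
  ≈ₚ-trans {∞} {∞} {∞} e f = tt

  P-cong : ∀ {u v} → u ≈ₚ v → ∀ j → P u j ≈ P v j
  P-cong {fin s} {fin t} e 0F = refl
  P-cong {fin s} {fin t} e 1F = e
  P-cong {fin s} {fin t} e 2F = *-cong e e
  P-cong {fin s} {fin t} e 3F = *-cong (*-cong e e) e
  P-cong {∞} {∞} e j = refl

  Π-cong : ∀ {u v} → u ≈ₚ v → ∀ j → Π u j ≈ Π v j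
  Π-cong {fin s} {fin t} e 0F = -‿cong (*-cong (*-cong e e) e)
  Π-cong {fin s} {fin t} e 1F = *-congˡ (*-cong e e)
  Π-cong {fin s} {fin t} e 2F = -‿cong (*-congˡ e)
  Π-cong {fin s} {fin t} e 3F = refl
  Π-cong {∞} {∞} e j = refl

  P-on-Π⇒≈ₚ : ∀ u v → OnPlane (P u) (Π v) → u ≈ₚ v
  P-on-Π⇒≈ₚ (fin t) (fin s) o = x-y≈0⇒x≈y (trans (solve 2 (λ t s → t :+ :- s := (:- s) :* con (+ 1) :+ con (+ 1) :* t) refl t s)
    (cube≈0⇒x≈0 (trans (sym (dot-W-V (- s) 1# 1# t)) (trans (sym (dot-cong (Π-fin≈W s) (P-fin≈V t))) o))))
  P-on-Π⇒≈ₚ (fin t) ∞ o = 1≉0 (trans (solve 1 (λ t →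
    con (+ 1) := con (+ 1) :* con (+ 1) :+ con (+ 0) :* t :+ con (+ 0) :* (t :* t) :+ con (+ 0) :* (t :* t :* t)) refl t) o)
  P-on-Π⇒≈ₚ ∞ (fin s) o = 1≉0 (trans (solve 1 (λ s →
    con (+ 1) := :- (s :* s :* s) :* con (+ 0) :+ con (+ 3) :* (s :* s) :* con (+ 0) :+ :- (con (+ 3) :* s) :* con (+ 0) :+ con (+ 1) :* con (+ 1)) refl s) o)
  P-on-Π⇒≈ₚ ∞ ∞ o = tt

  P∝P⇒≈ₚ : ∀ u v → P u ∝ P v → u ≈ₚ v
  P∝P⇒≈ₚ (fin t) (fin s) (c , _ , e) = trans (e 1F) (trans (*-congʳ c≈1) (*-identityˡ s))
    where c≈1 : c ≈ 1#
          c≈1 = sym (trans (e 0F) (*-identityʳ c))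
  P∝P⇒≈ₚ (fin t) ∞ (c , _ , e) = 1≉0 (trans (e 0F) (zeroʳ c))
  P∝P⇒≈ₚ ∞ (fin s) (c , c≉0 , e) = c≉0 (sym (trans (e 0F) (*-identityʳ c)))
  P∝P⇒≈ₚ ∞ ∞ _ = tt

  P-on-own-Π : ∀ u → OnPlane (P u) (Π u)
  P-on-own-Π (fin t) = trans (dot-cong (Π-fin≈W t) (P-fin≈V t))
    (trans (dot-W-V (- t) 1# 1# t) (solve 1 (λ t → cubeₑ ((:- t) :* con (+ 1) :+ con (+ 1) :* t) := con (+ 0)) refl t))
  P-on-own-Π ∞ = solve 0 (con (+ 1) :* con (+ 0) :+ con (+ 0) :* con (+ 0) :+ con (+ 0) :* con (+ 0) :+ con (+ 0) :* con (+ 1) := con (+ 0)) refl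

  record CubicCollineation : Set where
    field
      A A⁻ : Mat
      κ : Carrier
      κ≉0 : κ ≉ 0#
      A-A⁻ : ∀ v j → ((v · A) · A⁻) j ≈ κ * v j
      A⁻-A : ∀ v j → ((v · A⁻) · A) j ≈ κ * v j
      A▷A⁻▷ : ∀ π j → (A ▷ (A⁻ ▷ π)) j ≈ κ * π j
      A⁻▷A▷ : ∀ π j → (A⁻ ▷ (A ▷ π)) j ≈ κ * π j
      point : ∀ u → ∃[ u′ ] (P u · A) ∝ P u′
      point⁻ : ∀ u → ∃[ u′ ] (P u · A⁻) ∝ P u′
      plane : ∀ u → ∃[ u′ ] (A ▷ Π u) ∝ Π u′
      plane⁻ : ∀ u → ∃[ u′ ] (A⁻ ▷ Π u) ∝ Π u′

  inverse : CubicCollineation → CubicCollineation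
  inverse g = record
    { A = A⁻ ; A⁻ = A ; κ = κ ; κ≉0 = κ≉0 ; A-A⁻ = A⁻-A ; A⁻-A = A-A⁻ ; A▷A⁻▷ = A⁻▷A▷ ; A⁻▷A▷ = A▷A⁻▷
    ; point = point⁻ ; point⁻ = point ; plane = plane⁻ ; plane⁻ = plane }
    where open CubicCollineation g

  projectivity : ∀ a b c d → det a b c d ≉ 0# → CubicCollineation
  projectivity a b c d D≉0 = record
    { A = M a b c d ; A⁻ = M⁻ a b c d ; κ = cube (det a b c d) ; κ≉0 = cube-≉0 D≉0
    ; A-A⁻ = M-M⁻ a b c d ; A⁻-A = M⁻-M a b c d ; A▷A⁻▷ = M▷M⁻▷ a b c d ; A⁻▷A▷ = M⁻▷M▷ a b c d
    ; point = P·M∝P a b c d D≉0 ; point⁻ = P·M∝P d (- b) (- c) a D⁻≉0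
    ; plane = M▷Π∝Π a b c d D≉0 ; plane⁻ = M▷Π∝Π d (- b) (- c) a D⁻≉0 }
    where D⁻≉0 = D≉0 ∘ trans (sym (det-M⁻ a b c d))

  ImageBy : Mat → Line → Line → Set
  ImageBy A m ℓ = SpannedBy ℓ (p₁ m · A) (p₂ m · A)

  module _ (g : CubicCollineation) where
    open CubicCollineation g

    ∝-A-A⁻ : ∀ u → u ∝ ((u · A) · A⁻)
    ∝-A-A⁻ u = ∝-sym (κ , κ≉0 , A-A⁻ u)

    ∝-A⁻▷A▷ : ∀ π → π ∝ (A⁻ ▷ (A ▷ π))
    ∝-A⁻▷A▷ π = ∝-sym (κ , κ≉0 , A⁻▷A▷ π)

    ·A-reflects-∝ : ∀ {u v} → (u · A) ∝ (v · A) → u ∝ v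
    ·A-reflects-∝ {u} {v} p = ∝-trans (∝-A-A⁻ u) (∝-trans (∝-· A⁻ p) (∝-sym (∝-A-A⁻ v)))

    ▷A-reflects-∝ : ∀ {π ρ} → (A ▷ π) ∝ (A ▷ ρ) → π ∝ ρ
    ▷A-reflects-∝ {π} {ρ} p = ∝-trans (∝-A⁻▷A▷ π) (∝-trans (∝-▷ A⁻ p) (∝-sym (∝-A⁻▷A▷ ρ)))

    onPlane-▷⁺ : ∀ {u π} → OnPlane (u · A) π → OnPlane u (A ▷ π)
    onPlane-▷⁺ {u} {π} o = trans (sym (dot-· A π u)) o

    onPlane-▷⁻ : ∀ {u π} → OnPlane u (A ▷ π) → OnPlane (u · A) π
    onPlane-▷⁻ {u} {π} o = trans (dot-· A π u) o

    same-image : ∀ {s s′ w w′} → (P s · A) ∝ P w → (P s′ · A) ∝ P w′ → w ≈ₚ w′ → s ≈ₚ s′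
    same-image {s} {s′} {w} {w′} sw s′w′ w≈w′ =
      P∝P⇒≈ₚ s s′ (·A-reflects-∝ (∝-trans sw (∝-trans (≈⇒∝ (P-cong {w} {w′} w≈w′)) (∝-sym s′w′))))

    preimage : ∀ s → ∃[ s′ ] (P s′ · A) ∝ P s
    preimage s = let s′ , ss′ = point⁻ s in s′ , ∝-trans (∝-· A (∝-sym ss′)) (κ , κ≉0 , A⁻-A (P s))

    image-inverse : ∀ {m ℓ} → ImageBy A m ℓ → ImageBy A⁻ ℓ m
    image-inverse {m} {ℓ} ((s₁ , s₂) , (s₃ , s₄)) =
      (inSpan-∝ (∝-A-A⁻ (p₁ m)) (inSpan-· A⁻ s₃) , inSpan-∝ (∝-A-A⁻ (p₂ m)) (inSpan-· A⁻ s₄)) ,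
      (inSpan-rescale κ (A-A⁻ (p₁ m)) (A-A⁻ (p₂ m)) (inSpan-· A⁻ s₁) ,
       inSpan-rescale κ (A-A⁻ (p₁ m)) (A-A⁻ (p₂ m)) (inSpan-· A⁻ s₂))

    lineInPlane-preimage : ∀ {m ℓ π} → ImageBy A m ℓ → LineInPlane ℓ π → LineInPlane m (A ▷ π)
    lineInPlane-preimage {m} {ℓ} {π} (_ , (s₃ , s₄)) (o₁ , o₂) =
      onPlane-▷⁺ {p₁ m} {π} (onPlane-inSpan {π = π} s₃ o₁ o₂) , onPlane-▷⁺ {p₂ m} {π} (onPlane-inSpan {π = π} s₄ o₁ o₂)

    cubePoint-preimage : ∀ {m ℓ t} → ImageBy A m ℓ → OnLine (P t) ℓ → ∃[ u ] OnLine (P u) m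
    cubePoint-preimage {m} {ℓ} {t} ((s₁ , s₂) , _) o = let u , tu = point⁻ t in u , inSpan-∝ (∝-sym tu)
      (inSpan-rescale κ (A-A⁻ (p₁ m)) (A-A⁻ (p₂ m)) (inSpan-· A⁻ (inSpan-trans o s₁ s₂)))

    L₁-preimage : ∀ {m ℓ} → ImageBy A m ℓ → L₁ ℓ → L₁ m
    L₁-preimage {m} {ℓ} im (s , t , Πs≁Πt , ls , lt) = s′ , t′ , Πs′≁Πt′ ,
      lineInPlane-∝ {m} (∝-sym ps) (lineInPlane-preimage {m} {ℓ} {Π s} im ls) ,
      lineInPlane-∝ {m} (∝-sym pt) (lineInPlane-preimage {m} {ℓ} {Π t} im lt)
      where
      s′ = proj₁ (plane s)
      ps = proj₂ (plane s)
      t′ = proj₁ (plane t)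
      pt = proj₂ (plane t)
      Πs′≁Πt′ : ¬ Π s′ ∝ Π t′
      Πs′≁Πt′ q = Πs≁Πt (▷A-reflects-∝ (∝-trans ps (∝-trans q (∝-sym pt))))

    meetsCInExactlyTwo-▷ : ∀ {π} → MeetsCInExactlyTwo π → MeetsCInExactlyTwo (A ▷ π)
    meetsCInExactlyTwo-▷ {π} (s₁ , s₂ , s₁≉s₂ , o₁ , o₂ , only) =
      s₁′ , s₂′ , s₁′≉s₂′ , on {s₁} {s₁′} b₁ o₁ , on {s₂} {s₂′} b₂ o₂ , only′
      where
      s₁′ = proj₁ (preimage s₁)
      b₁ = proj₂ (preimage s₁)
      s₂′ = proj₁ (preimage s₂)
      b₂ = proj₂ (preimage s₂)
      on : ∀ {s s′} → (P s′ · A) ∝ P s → OnPlane (P s) π → OnPlane (P s′) (A ▷ π)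
      on {s} {s′} b o = onPlane-▷⁺ {P s′} {π} (onPlane-∝ {π = π} b o)
      s₁′≉s₂′ : ¬ s₁′ ≈ₚ s₂′
      s₁′≉s₂′ e = s₁≉s₂ (P∝P⇒≈ₚ s₁ s₂ (∝-trans (∝-sym b₁) (∝-trans (∝-· A (≈⇒∝ (P-cong {s₁′} {s₂′} e))) b₂)))
      only′ : ∀ s → OnPlane (P s) (A ▷ π) → (s ≈ₚ s₁′) ⊎ (s ≈ₚ s₂′)
      only′ s o = Sum.map (same-image {s} {s₁′} {w} {s₁} sw b₁) (same-image {s} {s₂′} {w} {s₂} sw b₂)
                          (only w (onPlane-∝ {π = π} (∝-sym sw) (onPlane-▷⁻ {P s} {π} o)))
        where
        w = proj₁ (point s)
        sw = proj₂ (point s)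

    L₄-preimage : ∀ {m ℓ} → ImageBy A m ℓ → L₄ ℓ → L₄ m
    L₄-preimage {m} {ℓ} im (t , π₂ , isPlane , ¬osc , two , P∉π₂ , lt , l₂) =
      t′ , A ▷ π₂ , isPlane′ , ¬osc′ , meetsCInExactlyTwo-▷ {π₂} two , P∉π₂′ ,
      lineInPlane-∝ {m} (∝-sym pt) (lineInPlane-preimage {m} {ℓ} {Π t} im lt) ,
      lineInPlane-preimage {m} {ℓ} {π₂} im l₂
      where
      t′ = proj₁ (plane t)
      pt = proj₂ (plane t)
      isPlane′ : IsPlane (A ▷ π₂)
      isPlane′ z = isPlane λ i → *-cancelˡ κ≉0
        (trans (sym (A⁻▷A▷ π₂ i)) (trans (▷-cong A⁻ z i) (trans (▷-0F A⁻ i) (sym (zeroʳ κ)))))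
      ¬osc′ : ¬ IsOsculatingPlane (A ▷ π₂)
      ¬osc′ (u , q) = let u′ , q′ = plane⁻ u in ¬osc (u′ , ∝-trans (∝-A⁻▷A▷ π₂) (∝-trans (∝-▷ A⁻ q) q′))
      w = proj₁ (point t′)
      t′w = proj₂ (point t′)
      on-image : ∀ π → OnPlane (P t′) (A ▷ π) → OnPlane (P w) π
      on-image π o = onPlane-∝ {π = π} (∝-sym t′w) (onPlane-▷⁻ {P t′} {π} o)
      w≈t : w ≈ₚ t
      w≈t = P-on-Π⇒≈ₚ w t (on-image (Π t) (onPlane-∝ᵖ {P t′} pt (P-on-own-Π t′)))
      P∉π₂′ : ¬ OnPlane (P t′) (A ▷ π₂)
      P∉π₂′ o = P∉π₂ (onPlane-∝ {π = π₂} (≈⇒∝ (P-cong {t} {w} (≈ₚ-sym {w} {t} w≈t))) (on-image π₂ o))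

    imageLine : Line → Line
    imageLine ℓ = line (p₁ ℓ · A) (p₂ ℓ · A) independent
      where
      independent : ∀ a b → (∀ i → a * (p₁ ℓ · A) i + b * (p₂ ℓ · A) i ≈ 0#) → (a ≈ 0# × b ≈ 0#)
      independent a b h = Line.indep ℓ a b combination≈0
        where
        combination : V4
        combination i = a * p₁ ℓ i + b * p₂ ℓ i
        combination≈0 : ∀ i → combination i ≈ 0#
        combination≈0 i = *-cancelˡ κ≉0 (begin
          κ * combination i             ≈⟨ sym (A-A⁻ combination i) ⟩
          ((combination · A) · A⁻) i    ≈⟨ ·-cong A⁻ (λ j → trans (·-linear A a b (p₁ ℓ) (p₂ ℓ) j) (h j)) i ⟩
          ((λ _ → 0#) · A⁻) i           ≈⟨ ·-0F A⁻ i ⟩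
          0#                            ≈⟨ sym (zeroʳ κ) ⟩
          κ * 0#                        ∎)

    imageLine-image : ∀ ℓ → ImageBy A ℓ (imageLine ℓ)
    imageLine-image ℓ = (inSpan-left (p₁ ℓ · A) (p₂ ℓ · A) , inSpan-right (p₁ ℓ · A) (p₂ ℓ · A)) ,
                        (inSpan-left (p₁ ℓ · A) (p₂ ℓ · A) , inSpan-right (p₁ ℓ · A) (p₂ ℓ · A))

  image-∘ : ∀ {A B C : Mat} {x y z} → (∀ v j → ((v · A) · B) j ≈ (v · C) j) → ImageBy A x y → ImageBy B y z → ImageBy C x z
  image-∘ {A} {B} {C} {x} {y} {z} AB≈C ((s₁ , s₂) , (s₃ , s₄)) ((t₁ , t₂) , (t₃ , t₄)) =
    (inSpan-trans t₁ (viaC (inSpan-· B s₁)) (viaC (inSpan-· B s₂)) ,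
     inSpan-trans t₂ (viaC (inSpan-· B s₁)) (viaC (inSpan-· B s₂))) ,
    (inSpan-≈ (AB≈C (p₁ x)) (inSpan-trans (inSpan-· B s₃) t₃ t₄) ,
     inSpan-≈ (AB≈C (p₂ x)) (inSpan-trans (inSpan-· B s₄) t₃ t₄))
    where
    viaC : ∀ {w} → InSpan w ((p₁ x · A) · B) ((p₂ x · A) · B) → InSpan w (p₁ x · C) (p₂ x · C)
    viaC = inSpan-rescale 1# (λ i → trans (AB≈C (p₁ x) i) (sym (*-identityˡ _))) (λ i → trans (AB≈C (p₂ x) i) (sym (*-identityˡ _)))
    inSpan-≈ : ∀ {w w′ u v} → (∀ i → w′ i ≈ w i) → InSpan w′ u v → InSpan w u v
    inSpan-≈ e (a , b , f) = a , b , λ i → trans (sym (e i)) (f i)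

  toΠ∞ : ∀ t → ∃[ a ] ∃[ b ] ∃[ c ] ∃[ d ] (det a b c d ≉ 0# × (M⁻ a b c d ▷ Π t) ∝ Π ∞)
  toΠ∞ (fin t) = t , 1# , - 1# , 0# , det≉0 , - 1# , -1≉0 , ≈-by-dot λ ρ → solve 5 (λ t ρ₀ ρ₁ ρ₂ ρ₃ →
      dotₑ (vecₑ ρ₀ ρ₁ ρ₂ ρ₃) (Mₑ (con (+ 0)) (:- con (+ 1)) (:- (:- con (+ 1))) t ▷ₑ Πₑ t)
    := dotₑ (vecₑ ρ₀ ρ₁ ρ₂ ρ₃) (λ j → :- con (+ 1) :* vecₑ (con (+ 1)) (con (+ 0)) (con (+ 0)) (con (+ 0)) j))
    refl t (ρ 0F) (ρ 1F) (ρ 2F) (ρ 3F)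
    where
    det≉0 : det t 1# (- 1#) 0# ≉ 0#
    det≉0 = 1≉0 ∘ trans (solve 1 (λ t → con (+ 1) := detₑ t (con (+ 1)) (:- con (+ 1)) (con (+ 0))) refl t)
  toΠ∞ ∞ = 1# , 0# , 0# , 1# , det≉0 , ≈⇒∝ (≈-by-dot λ ρ → solve 4 (λ ρ₀ ρ₁ ρ₂ ρ₃ →
      dotₑ (vecₑ ρ₀ ρ₁ ρ₂ ρ₃) (Mₑ (con (+ 1)) (:- con (+ 0)) (:- con (+ 0)) (con (+ 1)) ▷ₑ vecₑ (con (+ 1)) (con (+ 0)) (con (+ 0)) (con (+ 0)))
    := dotₑ (vecₑ ρ₀ ρ₁ ρ₂ ρ₃) (vecₑ (con (+ 1)) (con (+ 0)) (con (+ 0)) (con (+ 0))))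
    refl (ρ 0F) (ρ 1F) (ρ 2F) (ρ 3F))
    where
    det≉0 : det 1# 0# 0# 1# ≉ 0#
    det≉0 = 1≉0 ∘ trans (solve 0 (con (+ 1) := detₑ (con (+ 1)) (con (+ 0)) (con (+ 0)) (con (+ 1))) refl)

module Orbit (F : FiniteField) (ch : Geometry.CharNot2Or3 F) where
  open FiniteField F hiding (zero; inverse)
  open Geometry F
  open FieldLemmas F
  open Coordinates F
  open TwistedCubic F
  open Squares F using (IsSquare; isSquare?; nonSquare*nonSquare-isSquare)
  open IntegerRingSolver commRing using (solve; _:=_; Polynomial; con; _:+_; _:*_; :-_)
  open import Relation.Binary.Reasoning.Setoid setoid

  2≉0 : 2# ≉ 0#
  2≉0 = proj₁ ch

  3≉0 : 3# ≉ 0#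
  3≉0 = proj₂ ch

  3⁻¹ : Carrier
  3⁻¹ = recip 3# 3≉0

  33⁻¹-1≈0 : 3# * 3⁻¹ + - 1# ≈ 0#
  33⁻¹-1≈0 = x≈y⇒x-y≈0 (*-recip 3# 3≉0)

  module _ (n : Carrier) (¬□n : ¬ IsSquare n) where

    n≉0 : n ≉ 0#
    n≉0 n≈0 = ¬□n (0# , trans (zeroˡ 0#) (sym n≈0))

    q₁ q₂ : V4
    q₁ = vec 0# 1# 0# (3# * n)
    q₂ = vec 0# 0# 1# 0#

    ℓ₀ : Line
    ℓ₀ = line q₁ q₂ λ a b h →
      trans (solve 2 (λ a b → a := a :* con (+ 1) :+ b :* con (+ 0)) refl a b) (h 1F) ,
      trans (solve 2 (λ a b → b := a :* con (+ 0) :+ b :* con (+ 1)) refl a b) (h 2F)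

    ℓ₀⊆Π∞ : LineInPlane ℓ₀ (Π ∞)
    ℓ₀⊆Π∞ = solve 1 (λ n → dotₑ (vecₑ (con (+ 1)) (con (+ 0)) (con (+ 0)) (con (+ 0))) (vecₑ (con (+ 0)) (con (+ 1)) (con (+ 0)) (con (+ 3) :* n)) := con (+ 0)) refl n ,
            solve 0 (dotₑ (vecₑ (con (+ 1)) (con (+ 0)) (con (+ 0)) (con (+ 0))) (vecₑ (con (+ 0)) (con (+ 0)) (con (+ 1)) (con (+ 0))) := con (+ 0)) refl

    P∉ℓ₀ : ∀ u → ¬ OnLine (P u) ℓ₀
    P∉ℓ₀ (fin t) (a , b , e) = 1≉0 (trans (e 0F) (solve 2 (λ a b → a :* con (+ 0) :+ b :* con (+ 0) := con (+ 0)) refl a b))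
    P∉ℓ₀ ∞ (a , b , e) = 1≉0 (trans (e 3F)
      (≈-modulo (a * 1# + b * 0#) (3# * n)
        (solve 3 (λ a b n → a :* (con (+ 3) :* n) :+ b :* con (+ 0) := con (+ 0) :+ (con (+ 3) :* n) :* (a :* con (+ 1) :+ b :* con (+ 0))) refl a b n)
        (sym (e 1F))))

    Πu⊇ℓ₀⇒u≈∞ : ∀ u → LineInPlane ℓ₀ (Π u) → u ≈ₚ ∞
    Πu⊇ℓ₀⇒u≈∞ ∞ _ = tt
    Πu⊇ℓ₀⇒u≈∞ (fin s) (o₁ , o₂) = ¬□n (0# , trans (zeroˡ 0#) (sym n≈0))
      where
      s≈0 : s ≈ 0#
      s≈0 = [ ⊥-elim ∘ 3≉0 , id ]′ (x*y≈0⇒x≈0⊎y≈0 (≈-modulo (dot (Π (fin s)) q₂) (- 1#)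
        (solve 1 (λ s → con (+ 3) :* s := con (+ 0) :+ (:- con (+ 1)) :* dotₑ (Πₑ s) (vecₑ (con (+ 0)) (con (+ 0)) (con (+ 1)) (con (+ 0)))) refl s) o₂))
      n≈0 : n ≈ 0#
      n≈0 = [ ⊥-elim ∘ 3≉0 , id ]′ (x*y≈0⇒x≈0⊎y≈0 (≈-modulo₂ (dot (Π (fin s)) q₁) 1# s (- (3# * s))
        (solve 2 (λ s n → con (+ 3) :* n := con (+ 0) :+ con (+ 1) :* dotₑ (Πₑ s) (vecₑ (con (+ 0)) (con (+ 1)) (con (+ 0)) (con (+ 3) :* n)) :+ (:- (con (+ 3) :* s)) :* s) refl s n) o₁ s≈0))

    ¬L₁ℓ₀ : ¬ L₁ ℓ₀
    ¬L₁ℓ₀ (s , t , Πs≁Πt , ls , lt) = Πs≁Πt (≈⇒∝ (Π-cong {s} {t}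
      (≈ₚ-trans {s} {∞} {t} (Πu⊇ℓ₀⇒u≈∞ s ls) (≈ₚ-sym {t} {∞} (Πu⊇ℓ₀⇒u≈∞ t lt)))))

    ¬L₂ℓ₀ : ¬ L₂ ℓ₀
    ¬L₂ℓ₀ (fin t , spanned) = P∉ℓ₀ (fin t) (proj₁ (proj₂ spanned))
    ¬L₂ℓ₀ (∞ , spanned) = P∉ℓ₀ ∞ (proj₂ (proj₂ spanned))

    ¬L₃ℓ₀ : ¬ L₃ ℓ₀
    ¬L₃ℓ₀ (t , P∈ℓ₀ , _) = P∉ℓ₀ t P∈ℓ₀

    -- A plane through ℓ₀ has the form x Y₀ + y Y₁ + w Y₃ with y = - 3 n w, so
    -- it meets C in the roots of x + y r + w r³, whose three roots sum to 0.
    -- With exactly two distinct roots one of them is double, forcing r² = n.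
    ¬L₄ℓ₀ : ¬ L₄ ℓ₀
    ¬L₄ℓ₀ (t , π , _ , _ , (s₁ , s₂ , s₁≉s₂ , o₁ , o₂ , only) , Pt∉π , lt , (l₁ , l₂)) = two-roots s₁ s₂ s₁≉s₂ o₁ o₂ only
      where
      x = π 0F
      y = π 1F
      z = π 2F
      w = π 3F
      P∞∉π : ¬ OnPlane (P ∞) π
      P∞∉π o = Pt∉π (onPlane-∝ {π = π} (≈⇒∝ (P-cong {t} {∞} (Πu⊇ℓ₀⇒u≈∞ t lt))) o)
      w≉0 : w ≉ 0#
      w≉0 w≈0 = P∞∉π (≈-modulo w 1#
        (solve 4 (λ x y z w → dotₑ (vecₑ x y z w) (vecₑ (con (+ 0)) (con (+ 0)) (con (+ 0)) (con (+ 1))) := con (+ 0) :+ con (+ 1) :* w) refl x y z w) w≈0)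
      z≈0 : z ≈ 0#
      z≈0 = trans (solve 4 (λ x y z w → z := dotₑ (vecₑ x y z w) (vecₑ (con (+ 0)) (con (+ 0)) (con (+ 1)) (con (+ 0)))) refl x y z w) l₂
      Q : Carrier → Carrier → Carrier
      Q r r′ = y + z * (r + r′) + w * (r * r + r * r′ + r′ * r′)
      -- a double root r (with third root r′ = - 2 r) satisfies 3 w (r² - n) = 0
      double-root : ∀ r r′ → Q r r′ ≈ 0# → - r + - r′ ≈ r → ⊥
      double-root r r′ Q≈0 e = [ *-≉0 3≉0 w≉0 , (λ d → ¬□n (r , x-y≈0⇒x≈y d)) ]′ (x*y≈0⇒x≈0⊎y≈0
        (≈-modulo₄ (Q r r′) 1# z (- (r + r′)) (dot π q₁) (- 1#) (- r + - r′ + - r) (w * (r′ + - r))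
          (solve 7 (λ x y z w r r′ n → (con (+ 3) :* w) :* (r :* r :+ :- n) := con (+ 0)
              :+ con (+ 1) :* (y :+ z :* (r :+ r′) :+ w :* (r :* r :+ r :* r′ :+ r′ :* r′))
              :+ (:- (r :+ r′)) :* z
              :+ (:- con (+ 1)) :* dotₑ (vecₑ x y z w) (vecₑ (con (+ 0)) (con (+ 1)) (con (+ 0)) (con (+ 3) :* n))
              :+ (w :* (r′ :+ :- r)) :* (:- r :+ :- r′ :+ :- r)) refl x y z w r r′ n)
          Q≈0 z≈0 l₁ (x≈y⇒x-y≈0 e)))
      two-roots : ∀ s₁ s₂ → ¬ s₁ ≈ₚ s₂ → OnPlane (P s₁) π → OnPlane (P s₂) π → (∀ s → OnPlane (P s) π → (s ≈ₚ s₁) ⊎ (s ≈ₚ s₂)) → ⊥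
      two-roots ∞ _ _ o₁ _ _ = P∞∉π o₁
      two-roots (fin r₁) ∞ _ _ o₂ _ = P∞∉π o₂
      two-roots (fin r₁) (fin r₂) r₁≉r₂ o₁ o₂ only =
        [ double-root r₁ r₂ Q₁₂≈0 , double-root r₂ r₁ Q₂₁≈0 ∘ trans (+-comm _ _) ]′ (only (fin r₃) r₃∈π)
        where
        r₃ = - r₁ + - r₂
        Q₁₂≈0 : Q r₁ r₂ ≈ 0#
        Q₁₂≈0 = [ ⊥-elim ∘ r₁≉r₂ ∘ x-y≈0⇒x≈y , id ]′ (x*y≈0⇒x≈0⊎y≈0 (≈-modulo₂ (dot π (P (fin r₁))) 1# (dot π (P (fin r₂))) (- 1#)
          (solve 6 (λ x y z w r₁ r₂ → (r₁ :+ :- r₂) :* (y :+ z :* (r₁ :+ r₂) :+ w :* (r₁ :* r₁ :+ r₁ :* r₂ :+ r₂ :* r₂)) :=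
             con (+ 0) :+ con (+ 1) :* dotₑ (vecₑ x y z w) (Pₑ r₁)
             :+ (:- con (+ 1)) :* dotₑ (vecₑ x y z w) (Pₑ r₂)) refl x y z w r₁ r₂) o₁ o₂))
        Q₂₁≈0 : Q r₂ r₁ ≈ 0#
        Q₂₁≈0 = trans (solve 5 (λ y z w r₁ r₂ → y :+ z :* (r₂ :+ r₁) :+ w :* (r₂ :* r₂ :+ r₂ :* r₁ :+ r₁ :* r₁)
                                              := y :+ z :* (r₁ :+ r₂) :+ w :* (r₁ :* r₁ :+ r₁ :* r₂ :+ r₂ :* r₂))
                              refl y z w r₁ r₂) Q₁₂≈0
        r₃∈π : OnPlane (P (fin r₃)) π
        r₃∈π = ≈-modulo₃ (dot π (P (fin r₁))) 1# (Q r₁ r₂) (r₃ + - r₁) z (- ((r₃ + - r₁) * (r₁ + r₂ + r₂)))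
          (solve 6 (λ x y z w r₁ r₂ → let r₃ = :- r₁ :+ :- r₂ in
              dotₑ (vecₑ x y z w) (Pₑ r₃) :=
              con (+ 0) :+ con (+ 1) :* dotₑ (vecₑ x y z w) (Pₑ r₁)
              :+ (r₃ :+ :- r₁) :* (y :+ z :* (r₁ :+ r₂) :+ w :* (r₁ :* r₁ :+ r₁ :* r₂ :+ r₂ :* r₂))
              :+ (:- ((r₃ :+ :- r₁) :* (r₁ :+ r₂ :+ r₂))) :* z) refl x y z w r₁ r₂) o₁ Q₁₂≈0 z≈0

    L₅ℓ₀ : L₅ ℓ₀
    L₅ℓ₀ = (∞ , ℓ₀⊆Π∞) , ¬L₁ℓ₀ , ¬L₂ℓ₀ , ¬L₃ℓ₀ , ¬L₄ℓ₀

    module LineInΠ∞ (m : Line) (m⊆Π∞ : LineInPlane m (Π ∞)) (P∞∉m : ¬ OnLine (P ∞) m) where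
      u v : V4
      u = p₁ m
      v = p₂ m

      Y₀≈0 : ∀ {w} → OnPlane w (Π ∞) → w 0F ≈ 0#
      Y₀≈0 {w} o = trans (solve 4 (λ a b c d → a := dotₑ (vecₑ (con (+ 1)) (con (+ 0)) (con (+ 0)) (con (+ 0))) (vecₑ a b c d)) refl (w 0F) (w 1F) (w 2F) (w 3F)) o

      u₀≈0 : u 0F ≈ 0#
      u₀≈0 = Y₀≈0 {u} (proj₁ m⊆Π∞)

      v₀≈0 : v 0F ≈ 0#
      v₀≈0 = Y₀≈0 {v} (proj₂ m⊆Π∞)

      independent₁₂ : ∀ x y → x * u 1F + y * v 1F ≈ 0# → x * u 2F + y * v 2F ≈ 0# → x ≈ 0# × y ≈ 0#
      independent₁₂ x y h₁ h₂ = by-cases ((x * u 3F + y * v 3F) ≟ 0#)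
        where
        by-cases : Dec (x * u 3F + y * v 3F ≈ 0#) → x ≈ 0# × y ≈ 0#
        by-cases (yes h₃) = Line.indep m x y λ where
          0F → *+*≈0 x y u₀≈0 v₀≈0
          1F → h₁
          2F → h₂
          3F → h₃
        by-cases (no h₃) = ⊥-elim (P∞∉m (x * i , y * i , λ where
            0F → sym (*+*≈0 (x * i) (y * i) u₀≈0 v₀≈0)
            1F → sym (≈-modulo (x * u 1F + y * v 1F) i (solve 5 (λ x y i u v → x :* i :* u :+ y :* i :* v := con (+ 0) :+ i :* (x :* u :+ y :* v)) refl x y i (u 1F) (v 1F)) h₁)
            2F → sym (≈-modulo (x * u 2F + y * v 2F) i (solve 5 (λ x y i u v → x :* i :* u :+ y :* i :* v := con (+ 0) :+ i :* (x :* u :+ y :* v)) refl x y i (u 2F) (v 2F)) h₂)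
            3F → sym (trans (solve 5 (λ x y i u v → x :* i :* u :+ y :* i :* v := (x :* u :+ y :* v) :* i) refl x y i (u 3F) (v 3F)) (*-recip _ h₃))))
          where i = recip (x * u 3F + y * v 3F) h₃

      Δ : Carrier
      Δ = u 1F * v 2F + - (u 2F * v 1F)

      Δ≉0 : Δ ≉ 0#
      Δ≉0 Δ≈0 = 1≉0 (proj₁ (independent₁₂ 1# 0# (trivial u₁≈0) (trivial u₂≈0)))
        where
        u₁ = u 1F ; u₂ = u 2F ; v₁ = v 1F ; v₂ = v 2F
        trivial : ∀ {a b} → a ≈ 0# → 1# * a + 0# * b ≈ 0#
        trivial {a} {b} a≈0 = ≈-modulo a 1# (solve 2 (λ a b → con (+ 1) :* a :+ con (+ 0) :* b := con (+ 0) :+ con (+ 1) :* a) refl a b) a≈0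
        -x≈0⇒x≈0 : ∀ {x} → - x ≈ 0# → x ≈ 0#
        -x≈0⇒x≈0 {x} e = ≈-modulo (- x) (- 1#) (solve 1 (λ x → x := con (+ 0) :+ (:- con (+ 1)) :* (:- x)) refl x) e
        step₁ = independent₁₂ v₂ (- u₂) (trans (solve 4 (λ u₁ u₂ v₁ v₂ → v₂ :* u₁ :+ (:- u₂) :* v₁ := u₁ :* v₂ :+ :- (u₂ :* v₁)) refl u₁ u₂ v₁ v₂) Δ≈0)
                                          (solve 2 (λ u₂ v₂ → v₂ :* u₂ :+ (:- u₂) :* v₂ := con (+ 0)) refl u₂ v₂)
        u₂≈0 : u₂ ≈ 0#
        u₂≈0 = -x≈0⇒x≈0 (proj₂ step₁)
        u₁≈0 : u₁ ≈ 0#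
        u₁≈0 = -x≈0⇒x≈0 (proj₂ (independent₁₂ v₁ (- u₁) (solve 2 (λ u₁ v₁ → v₁ :* u₁ :+ (:- u₁) :* v₁ := con (+ 0)) refl u₁ v₁)
          (*+*≈0 v₁ (- u₁) u₂≈0 (proj₁ step₁))))

      Δ⁻¹ = recip Δ Δ≉0

      ΔΔ⁻¹-1≈0 : Δ * Δ⁻¹ + - 1# ≈ 0#
      ΔΔ⁻¹-1≈0 = x≈y⇒x-y≈0 (*-recip Δ Δ≉0)

      γ δ : Carrier
      γ = (v 2F * u 3F + - (u 2F * v 3F)) * Δ⁻¹
      δ = (u 1F * v 3F + - (v 1F * u 3F)) * Δ⁻¹

      e₁ e₂ : V4
      e₁ = vec 0# 1# 0# γ
      e₂ = vec 0# 0# 1# δ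

      inSpan-e : ∀ w → w 0F ≈ 0# → w 3F ≈ w 1F * γ + w 2F * δ → InSpan w e₁ e₂
      inSpan-e w w₀≈0 w₃≈ = w 1F , w 2F , λ where
        0F → ≈-modulo (w 0F) 1# (solve 3 (λ w₀ w₁ w₂ → w₀ := w₁ :* con (+ 0) :+ w₂ :* con (+ 0) :+ con (+ 1) :* w₀) refl (w 0F) (w 1F) (w 2F)) w₀≈0
        1F → solve 2 (λ w₁ w₂ → w₁ := w₁ :* con (+ 1) :+ w₂ :* con (+ 0)) refl (w 1F) (w 2F)
        2F → solve 2 (λ w₁ w₂ → w₂ := w₁ :* con (+ 0) :+ w₂ :* con (+ 1)) refl (w 1F) (w 2F)
        3F → w₃≈

      -- Cramer's rule for the last coordinate of u and v.
      u₃≈ : u 3F ≈ u 1F * γ + u 2F * δ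
      u₃≈ = ≈-modulo (Δ * Δ⁻¹ + - 1#) (- u 3F) (solve 7 (λ u₁ u₂ u₃ v₁ v₂ v₃ i →
          u₃ := u₁ :* ((v₂ :* u₃ :+ :- (u₂ :* v₃)) :* i) :+ u₂ :* ((u₁ :* v₃ :+ :- (v₁ :* u₃)) :* i) :+ (:- u₃) :* ((u₁ :* v₂ :+ :- (u₂ :* v₁)) :* i :+ :- con (+ 1)))
        refl (u 1F) (u 2F) (u 3F) (v 1F) (v 2F) (v 3F) Δ⁻¹) ΔΔ⁻¹-1≈0

      v₃≈ : v 3F ≈ v 1F * γ + v 2F * δ
      v₃≈ = ≈-modulo (Δ * Δ⁻¹ + - 1#) (- v 3F) (solve 7 (λ u₁ u₂ u₃ v₁ v₂ v₃ i →
          v₃ := v₁ :* ((v₂ :* u₃ :+ :- (u₂ :* v₃)) :* i) :+ v₂ :* ((u₁ :* v₃ :+ :- (v₁ :* u₃)) :* i) :+ (:- v₃) :* ((u₁ :* v₂ :+ :- (u₂ :* v₁)) :* i :+ :- con (+ 1)))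
        refl (u 1F) (u 2F) (u 3F) (v 1F) (v 2F) (v 3F) Δ⁻¹) ΔΔ⁻¹-1≈0

      e₁∈m : InSpan e₁ u v
      e₁∈m = v 2F * Δ⁻¹ , - (u 2F * Δ⁻¹) , λ where
        0F → sym (*+*≈0 (v 2F * Δ⁻¹) (- (u 2F * Δ⁻¹)) u₀≈0 v₀≈0)
        1F → sym (≈-modulo (Δ * Δ⁻¹ + - 1#) 1# (solve 5 (λ u₁ u₂ v₁ v₂ i → v₂ :* i :* u₁ :+ :- (u₂ :* i) :* v₁ := con (+ 1) :+ con (+ 1) :* ((u₁ :* v₂ :+ :- (u₂ :* v₁)) :* i :+ :- con (+ 1))) refl (u 1F) (u 2F) (v 1F) (v 2F) Δ⁻¹) ΔΔ⁻¹-1≈0)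
        2F → solve 3 (λ u₂ v₂ i → con (+ 0) := v₂ :* i :* u₂ :+ :- (u₂ :* i) :* v₂) refl (u 2F) (v 2F) Δ⁻¹
        3F → solve 5 (λ u₂ u₃ v₂ v₃ i → (v₂ :* u₃ :+ :- (u₂ :* v₃)) :* i := v₂ :* i :* u₃ :+ :- (u₂ :* i) :* v₃) refl (u 2F) (u 3F) (v 2F) (v 3F) Δ⁻¹

      e₂∈m : InSpan e₂ u v
      e₂∈m = - (v 1F * Δ⁻¹) , u 1F * Δ⁻¹ , λ where
        0F → sym (*+*≈0 (- (v 1F * Δ⁻¹)) (u 1F * Δ⁻¹) u₀≈0 v₀≈0)
        1F → solve 3 (λ u₁ v₁ i → con (+ 0) := :- (v₁ :* i) :* u₁ :+ u₁ :* i :* v₁) refl (u 1F) (v 1F) Δ⁻¹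
        2F → sym (≈-modulo (Δ * Δ⁻¹ + - 1#) 1# (solve 5 (λ u₁ u₂ v₁ v₂ i → :- (v₁ :* i) :* u₂ :+ u₁ :* i :* v₂ := con (+ 1) :+ con (+ 1) :* ((u₁ :* v₂ :+ :- (u₂ :* v₁)) :* i :+ :- con (+ 1))) refl (u 1F) (u 2F) (v 1F) (v 2F) Δ⁻¹) ΔΔ⁻¹-1≈0)
        3F → solve 5 (λ u₁ u₃ v₁ v₃ i → (u₁ :* v₃ :+ :- (v₁ :* u₃)) :* i := :- (v₁ :* i) :* u₃ :+ u₁ :* i :* v₃) refl (u 1F) (u 3F) (v 1F) (v 3F) Δ⁻¹

      m-spannedBy-e : SpannedBy m e₁ e₂
      m-spannedBy-e = (inSpan-e u u₀≈0 u₃≈ , inSpan-e v v₀≈0 v₃≈) , (e₁∈m , e₂∈m)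

      D : Carrier
      D = δ * δ + 3# * γ

      D≈0⇒L₁ : D ≈ 0# → L₁ m
      D≈0⇒L₁ D≈0 = ∞ , fin s , Π∞≁Πs , m⊆Π∞ , lineInPlane-spannedBy {m} {π = Π (fin s)} m-spannedBy-e e₁∈Πs e₂∈Πs
        where
        s = δ * 3⁻¹
        e₁∈Πs : OnPlane e₁ (Π (fin s))
        e₁∈Πs = ≈-modulo₂ D 3⁻¹ (3# * 3⁻¹ + - 1#) (3⁻¹ * δ * δ + - γ)
          (solve 3 (λ γ δ i → dotₑ (Πₑ (δ :* i)) (vecₑ (con (+ 0)) (con (+ 1)) (con (+ 0)) γ)
             := con (+ 0) :+ i :* (δ :* δ :+ con (+ 3) :* γ) :+ (i :* δ :* δ :+ :- γ) :* (con (+ 3) :* i :+ :- con (+ 1))) refl γ δ 3⁻¹) D≈0 33⁻¹-1≈0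
        e₂∈Πs : OnPlane e₂ (Π (fin s))
        e₂∈Πs = ≈-modulo (3# * 3⁻¹ + - 1#) (- δ)
          (solve 2 (λ δ i → dotₑ (Πₑ (δ :* i)) (vecₑ (con (+ 0)) (con (+ 0)) (con (+ 1)) δ)
             := con (+ 0) :+ (:- δ) :* (con (+ 3) :* i :+ :- con (+ 1))) refl δ 3⁻¹) 33⁻¹-1≈0
        Π∞≁Πs : ¬ Π ∞ ∝ Π (fin s)
        Π∞≁Πs (c , c≉0 , e) = c≉0 (sym (trans (e 3F) (*-identityʳ c)))

      -- With D = r², the plane c₀ Y₀ + α Y₁ + β Y₂ + Y₃ through m meets C in
      -- the roots of (t - ρ)² (t - σ), a double root ρ and a simple root σ.
      D-square⇒L₄ : D ≉ 0# → IsSquare D → L₄ m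
      D-square⇒L₄ D≉0 (r , rr≈D) = ∞ , π , isPlane , ¬osculating , (fin ρ , fin σ , ρ≉σ , ρ∈π , σ∈π , only) ,
                                     P∞∉π , m⊆Π∞ , lineInPlane-spannedBy {m} {π = π} m-spannedBy-e e₁∈π e₂∈π
        where
        α β ρ σ c₀ : Carrier
        α = - γ
        β = - δ
        ρ = (r + - β) * 3⁻¹
        σ = - β + - (2# * ρ)
        c₀ = ρ * ρ * ρ + ρ * ρ * ρ + β * (ρ * ρ)
        π : V4
        π = vec c₀ α β 1#
        r≉0 : r ≉ 0#
        r≉0 r≈0 = D≉0 (trans (sym rr≈D) (trans (*-cong r≈0 r≈0) (zeroˡ 0#)))
        ρ-critical : α + 3# * (ρ * ρ) + 2# * (β * ρ) ≈ 0#
        ρ-critical = ≈-modulo₂ (3# * 3⁻¹ + - 1#) ((r + δ) * (r + δ) * 3⁻¹ + γ) (r * r + - D) 3⁻¹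
          (solve 4 (λ γ δ r i → :- γ :+ con (+ 3) :* (((r :+ :- (:- δ)) :* i) :* ((r :+ :- (:- δ)) :* i)) :+ con (+ 2) :* ((:- δ) :* ((r :+ :- (:- δ)) :* i))
             := con (+ 0) :+ ((r :+ δ) :* (r :+ δ) :* i :+ γ) :* (con (+ 3) :* i :+ :- con (+ 1)) :+ i :* (r :* r :+ :- (δ :* δ :+ con (+ 3) :* γ))) refl γ δ r 3⁻¹)
          33⁻¹-1≈0 (x≈y⇒x-y≈0 rr≈D)
        factorisation : ∀ t → dot π (P (fin t)) ≈ (t + - ρ) * (t + - ρ) * (t + - σ)
        factorisation t = ≈-modulo (α + 3# * (ρ * ρ) + 2# * (β * ρ)) t
          (solve 4 (λ t α β ρ → dotₑ (vecₑ (ρ :* ρ :* ρ :+ ρ :* ρ :* ρ :+ β :* (ρ :* ρ)) α β (con (+ 1))) (Pₑ t)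
             := (t :+ :- ρ) :* (t :+ :- ρ) :* (t :+ :- (:- β :+ :- (con (+ 2) :* ρ))) :+ t :* (α :+ con (+ 3) :* (ρ :* ρ) :+ con (+ 2) :* (β :* ρ))) refl t α β ρ) ρ-critical
        ρ∈π : OnPlane (P (fin ρ)) π
        ρ∈π = trans (factorisation ρ) (solve 2 (λ ρ σ → (ρ :+ :- ρ) :* (ρ :+ :- ρ) :* (ρ :+ :- σ) := con (+ 0)) refl ρ σ)
        σ∈π : OnPlane (P (fin σ)) π
        σ∈π = trans (factorisation σ) (solve 2 (λ ρ σ → (σ :+ :- ρ) :* (σ :+ :- ρ) :* (σ :+ :- σ) := con (+ 0)) refl ρ σ)
        ρ≉σ : ¬ ρ ≈ σ
        ρ≉σ e = r≉0 (≈-modulo₂ (ρ + - σ) 1# (3# * 3⁻¹ + - 1#) (- (r + - β))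
          (solve 3 (λ δ r i → r := con (+ 0) :+ con (+ 1) :* ((r :+ :- (:- δ)) :* i :+ :- (:- (:- δ) :+ :- (con (+ 2) :* ((r :+ :- (:- δ)) :* i))))
             :+ (:- (r :+ :- (:- δ))) :* (con (+ 3) :* i :+ :- con (+ 1))) refl δ r 3⁻¹)
          (x≈y⇒x-y≈0 e) 33⁻¹-1≈0)
        P∞∉π : ¬ OnPlane (P ∞) π
        P∞∉π o = 1≉0 (trans (solve 3 (λ c₀ α β → con (+ 1) := dotₑ (vecₑ c₀ α β (con (+ 1))) (vecₑ (con (+ 0)) (con (+ 0)) (con (+ 0)) (con (+ 1)))) refl c₀ α β) o)
        isPlane : IsPlane π
        isPlane π≈0 = 1≉0 (π≈0 3F)
        -- an osculating plane through m would force D = 0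
        ¬osculating : ¬ IsOsculatingPlane π
        ¬osculating (∞ , c , _ , e) = 1≉0 (trans (e 3F) (zeroʳ c))
        ¬osculating (fin s , c , _ , e) = r≉0 (cube≈0⇒x≈0 (trans (solve 1 (λ r → r :* r :* r := r :* (r :* r)) refl r) (trans (*-congˡ (trans rr≈D D≈0)) (zeroʳ r))))
          where
          x = c * - (3# * s)
          D≈0 : D ≈ 0#
          D≈0 = ≈-modulo₃ (β + - x) (2# * x + (β + - x)) (α + - (c * (3# * (s * s)))) (- 3#) (1# + - (c * 1#)) (- (3# * (3# * (c * (s * s)))))
            (solve 4 (λ γ δ c s → δ :* δ :+ con (+ 3) :* γ := con (+ 0)
               :+ (con (+ 2) :* (c :* :- (con (+ 3) :* s)) :+ (:- δ :+ :- (c :* :- (con (+ 3) :* s)))) :* (:- δ :+ :- (c :* :- (con (+ 3) :* s)))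
               :+ (:- con (+ 3)) :* (:- γ :+ :- (c :* (con (+ 3) :* (s :* s))))
               :+ (:- (con (+ 3) :* (con (+ 3) :* (c :* (s :* s))))) :* (con (+ 1) :+ :- (c :* con (+ 1)))) refl γ δ c s)
            (x≈y⇒x-y≈0 (e 2F)) (x≈y⇒x-y≈0 (e 1F)) (x≈y⇒x-y≈0 (e 3F))
        e₁∈π : OnPlane e₁ π
        e₁∈π = solve 3 (λ c₀ γ β → dotₑ (vecₑ c₀ (:- γ) β (con (+ 1))) (vecₑ (con (+ 0)) (con (+ 1)) (con (+ 0)) γ) := con (+ 0)) refl c₀ γ β
        e₂∈π : OnPlane e₂ π
        e₂∈π = solve 3 (λ c₀ α δ → dotₑ (vecₑ c₀ α (:- δ) (con (+ 1))) (vecₑ (con (+ 0)) (con (+ 0)) (con (+ 1)) δ) := con (+ 0)) refl c₀ α δ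
        only : ∀ s → OnPlane (P s) π → (s ≈ₚ fin ρ) ⊎ (s ≈ₚ fin σ)
        only ∞ o = ⊥-elim (P∞∉π o)
        only (fin t) o = Sum.map (x-y≈0⇒x≈y ∘ x*x≈0⇒x≈0) x-y≈0⇒x≈y
          (x*y≈0⇒x≈0⊎y≈0 {(t + - ρ) * (t + - ρ)} {t + - σ} (trans (sym (factorisation t)) o))

      -- With D a nonsquare, n D = w² and M(1, δ/3, 0, w/(3n)) maps ℓ₀ onto m.
      D-nonsquare⇒image : ¬ IsSquare D → ∃[ a ] ∃[ b ] ∃[ c ] ∃[ d ] (det a b c d ≉ 0# × ImageUnder a b c d ℓ₀ m)
      D-nonsquare⇒image ¬□D = 1# , b , 0# , d , det≉0 ,
        spannedBy-trans {m} {e₁} {e₂} {Q₁} {Q₂} m-spannedBy-e e₁∈Q e₂∈Q Q₁∈e Q₂∈e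
        where
        D≉0 : D ≉ 0#
        D≉0 D≈0 = ¬□D (0# , trans (zeroˡ 0#) (sym D≈0))
        nD-square = nonSquare*nonSquare-isSquare 2≉0 ¬□n ¬□D
        w = proj₁ nD-square
        ww-nD≈0 : w * w + - (n * D) ≈ 0#
        ww-nD≈0 = x≈y⇒x-y≈0 (proj₂ nD-square)
        k = 3# * n
        k≉0 : k ≉ 0#
        k≉0 = *-≉0 3≉0 n≉0
        k⁻¹ = recip k k≉0
        kk⁻¹-1≈0 : k * k⁻¹ + - 1# ≈ 0#
        kk⁻¹-1≈0 = x≈y⇒x-y≈0 (*-recip k k≉0)
        k⁻¹≉0 : k⁻¹ ≉ 0#
        k⁻¹≉0 e = 1≉0 (trans (sym (*-recip k k≉0)) (trans (*-congˡ e) (zeroʳ k)))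
        w≉0 : w ≉ 0#
        w≉0 e = *-≉0 n≉0 D≉0 (trans (sym (proj₂ nD-square)) (trans (*-cong e e) (zeroˡ 0#)))
        b d : Carrier
        b = δ * 3⁻¹
        d = w * k⁻¹
        d≉0 : d ≉ 0#
        d≉0 = *-≉0 w≉0 k⁻¹≉0
        det≉0 : det 1# b 0# d ≉ 0#
        det≉0 e = d≉0 (trans (solve 2 (λ b d → d := detₑ (con (+ 1)) b (con (+ 0)) d) refl b d) e)
        d⁻¹ = recip d d≉0
        dd⁻¹-1≈0 : d * d⁻¹ + - 1# ≈ 0#
        dd⁻¹-1≈0 = x≈y⇒x-y≈0 (*-recip d d≉0)
        δ≈3b : δ + - (3# * b) ≈ 0#
        δ≈3b = ≈-modulo (3# * 3⁻¹ + - 1#) (- δ) (solve 2 (λ δ i → δ :+ :- (con (+ 3) :* (δ :* i)) := con (+ 0) :+ (:- δ) :* (con (+ 3) :* i :+ :- con (+ 1))) refl δ 3⁻¹) 33⁻¹-1≈0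
        9nd²≈D : 3# * (3# * n) * (d * d) + - D ≈ 0#
        9nd²≈D = ≈-modulo₂ (w * w + - (n * D)) (3# * (3# * n) * (k⁻¹ * k⁻¹)) (k * k⁻¹ + - 1#) (D * (k * k⁻¹ + 1#))
          (solve 4 (λ n w i D → con (+ 3) :* (con (+ 3) :* n) :* ((w :* i) :* (w :* i)) :+ :- D := con (+ 0)
             :+ (con (+ 3) :* (con (+ 3) :* n) :* (i :* i)) :* (w :* w :+ :- (n :* D)) :+ (D :* (con (+ 3) :* n :* i :+ con (+ 1))) :* (con (+ 3) :* n :* i :+ :- con (+ 1))) refl n w k⁻¹ D)
          ww-nD≈0 kk⁻¹-1≈0
        γ≈ : γ + - (3# * n * (d * d) + - (3# * (b * b))) ≈ 0#
        γ≈ = [ ⊥-elim ∘ 3≉0 , id ]′ (x*y≈0⇒x≈0⊎y≈0 (≈-modulo₂ (3# * (3# * n) * (d * d) + - D) (- 1#) (δ + - (3# * b)) (- (δ + 3# * b))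
          (solve 5 (λ γ δ n d b → con (+ 3) :* (γ :+ :- (con (+ 3) :* n :* (d :* d) :+ :- (con (+ 3) :* (b :* b)))) := con (+ 0)
             :+ (:- con (+ 1)) :* (con (+ 3) :* (con (+ 3) :* n) :* (d :* d) :+ :- (δ :* δ :+ con (+ 3) :* γ)) :+ (:- (δ :+ con (+ 3) :* b)) :* (δ :+ :- (con (+ 3) :* b))) refl γ δ n d b)
          9nd²≈D δ≈3b))
        Q₁ Q₂ : V4
        Q₁ = q₁ · M 1# b 0# d
        Q₂ = q₂ · M 1# b 0# d
        q₁ₑ q₂ₑ : ∀ {n} → Polynomial n → Fin 4 → Polynomial n
        q₁ₑ n = vecₑ (con (+ 0)) (con (+ 1)) (con (+ 0)) (con (+ 3) :* n)
        q₂ₑ _ = vecₑ (con (+ 0)) (con (+ 0)) (con (+ 1)) (con (+ 0))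
        Q₁∈e : InSpan Q₁ e₁ e₂
        Q₁∈e = d , 2# * (b * d) , λ where
          0F → solve 3 (λ n b d → (q₁ₑ n ·ₑ Mₑ (con (+ 1)) b (con (+ 0)) d) 0F := d :* con (+ 0) :+ con (+ 2) :* (b :* d) :* con (+ 0)) refl n b d
          1F → solve 3 (λ n b d → (q₁ₑ n ·ₑ Mₑ (con (+ 1)) b (con (+ 0)) d) 1F := d :* con (+ 1) :+ con (+ 2) :* (b :* d) :* con (+ 0)) refl n b d
          2F → solve 3 (λ n b d → (q₁ₑ n ·ₑ Mₑ (con (+ 1)) b (con (+ 0)) d) 2F := d :* con (+ 0) :+ con (+ 2) :* (b :* d) :* con (+ 1)) refl n b d
          3F → ≈-modulo₂ (γ + - (3# * n * (d * d) + - (3# * (b * b)))) (- d) (δ + - (3# * b)) (- (2# * (b * d)))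
            (solve 5 (λ γ δ n b d → (q₁ₑ n ·ₑ Mₑ (con (+ 1)) b (con (+ 0)) d) 3F
               := d :* γ :+ con (+ 2) :* (b :* d) :* δ :+ (:- d) :* (γ :+ :- (con (+ 3) :* n :* (d :* d) :+ :- (con (+ 3) :* (b :* b)))) :+ (:- (con (+ 2) :* (b :* d))) :* (δ :+ :- (con (+ 3) :* b))) refl γ δ n b d)
            γ≈ δ≈3b
        Q₂∈e : InSpan Q₂ e₁ e₂
        Q₂∈e = 0# , d * d , λ where
          0F → solve 2 (λ b d → (q₂ₑ b ·ₑ Mₑ (con (+ 1)) b (con (+ 0)) d) 0F := con (+ 0) :* con (+ 0) :+ d :* d :* con (+ 0)) refl b d
          1F → solve 2 (λ b d → (q₂ₑ b ·ₑ Mₑ (con (+ 1)) b (con (+ 0)) d) 1F := con (+ 0) :* con (+ 1) :+ d :* d :* con (+ 0)) refl b d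
          2F → solve 2 (λ b d → (q₂ₑ b ·ₑ Mₑ (con (+ 1)) b (con (+ 0)) d) 2F := con (+ 0) :* con (+ 0) :+ d :* d :* con (+ 1)) refl b d
          3F → ≈-modulo (δ + - (3# * b)) (- (d * d))
            (solve 4 (λ γ δ b d → (q₂ₑ b ·ₑ Mₑ (con (+ 1)) b (con (+ 0)) d) 3F := con (+ 0) :* γ :+ d :* d :* δ :+ (:- (d :* d)) :* (δ :+ :- (con (+ 3) :* b))) refl γ δ b d)
            δ≈3b
        e₁∈Q : InSpan e₁ Q₁ Q₂
        e₁∈Q = d⁻¹ , - (2# * b * (d⁻¹ * d⁻¹)) , λ where
          0F → solve 4 (λ n b d i → con (+ 0) := i :* (q₁ₑ n ·ₑ Mₑ (con (+ 1)) b (con (+ 0)) d) 0F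
                 :+ :- (con (+ 2) :* b :* (i :* i)) :* (q₂ₑ n ·ₑ Mₑ (con (+ 1)) b (con (+ 0)) d) 0F) refl n b d d⁻¹
          1F → ≈-modulo (d * d⁻¹ + - 1#) (- 1#) (solve 4 (λ n b d i → con (+ 1) := i :* (q₁ₑ n ·ₑ Mₑ (con (+ 1)) b (con (+ 0)) d) 1F
                 :+ :- (con (+ 2) :* b :* (i :* i)) :* (q₂ₑ n ·ₑ Mₑ (con (+ 1)) b (con (+ 0)) d) 1F
                 :+ (:- con (+ 1)) :* (d :* i :+ :- con (+ 1))) refl n b d d⁻¹) dd⁻¹-1≈0
          2F → ≈-modulo (d * d⁻¹ + - 1#) (2# * b * d⁻¹ * d) (solve 4 (λ n b d i → con (+ 0) := i :* (q₁ₑ n ·ₑ Mₑ (con (+ 1)) b (con (+ 0)) d) 2F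
                 :+ :- (con (+ 2) :* b :* (i :* i)) :* (q₂ₑ n ·ₑ Mₑ (con (+ 1)) b (con (+ 0)) d) 2F
                 :+ (con (+ 2) :* b :* i :* d) :* (d :* i :+ :- con (+ 1))) refl n b d d⁻¹) dd⁻¹-1≈0
          3F → ≈-modulo₂ (γ + - (3# * n * (d * d) + - (3# * (b * b)))) 1# (d * d⁻¹ + - 1#)
                 (- (3# * (b * b) + 3# * n * (d * d) + - (3# * (3# * (b * b))) + - (3# * (b * b)) + - (2# * (3# * (b * b)) * (d * d⁻¹ + - 1#))))
            (solve 5 (λ γ n b d i → γ := i :* (q₁ₑ n ·ₑ Mₑ (con (+ 1)) b (con (+ 0)) d) 3F
                 :+ :- (con (+ 2) :* b :* (i :* i)) :* (q₂ₑ n ·ₑ Mₑ (con (+ 1)) b (con (+ 0)) d) 3F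
                 :+ con (+ 1) :* (γ :+ :- (con (+ 3) :* n :* (d :* d) :+ :- (con (+ 3) :* (b :* b))))
                 :+ (:- (con (+ 3) :* (b :* b) :+ con (+ 3) :* n :* (d :* d) :+ :- (con (+ 3) :* (con (+ 3) :* (b :* b))) :+ :- (con (+ 3) :* (b :* b))
                     :+ :- (con (+ 2) :* (con (+ 3) :* (b :* b)) :* (d :* i :+ :- con (+ 1))))) :* (d :* i :+ :- con (+ 1))) refl γ n b d d⁻¹)
            γ≈ dd⁻¹-1≈0
        e₂∈Q : InSpan e₂ Q₁ Q₂
        e₂∈Q = 0# , d⁻¹ * d⁻¹ , λ where
          0F → solve 4 (λ n b d i → con (+ 0) := con (+ 0) :* (q₁ₑ n ·ₑ Mₑ (con (+ 1)) b (con (+ 0)) d) 0F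
                 :+ i :* i :* (q₂ₑ n ·ₑ Mₑ (con (+ 1)) b (con (+ 0)) d) 0F) refl n b d d⁻¹
          1F → solve 4 (λ n b d i → con (+ 0) := con (+ 0) :* (q₁ₑ n ·ₑ Mₑ (con (+ 1)) b (con (+ 0)) d) 1F
                 :+ i :* i :* (q₂ₑ n ·ₑ Mₑ (con (+ 1)) b (con (+ 0)) d) 1F) refl n b d d⁻¹
          2F → ≈-modulo (d * d⁻¹ + - 1#) (- (d * d⁻¹ + 1#)) (solve 4 (λ n b d i → con (+ 1) := con (+ 0) :* (q₁ₑ n ·ₑ Mₑ (con (+ 1)) b (con (+ 0)) d) 2F
                 :+ i :* i :* (q₂ₑ n ·ₑ Mₑ (con (+ 1)) b (con (+ 0)) d) 2F
                 :+ (:- (d :* i :+ con (+ 1))) :* (d :* i :+ :- con (+ 1))) refl n b d d⁻¹) dd⁻¹-1≈0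
          3F → ≈-modulo₂ (δ + - (3# * b)) 1# (d * d⁻¹ + - 1#) (- (3# * b * (d * d⁻¹ + 1#)))
            (solve 5 (λ δ n b d i → δ := con (+ 0) :* (q₁ₑ n ·ₑ Mₑ (con (+ 1)) b (con (+ 0)) d) 3F
                 :+ i :* i :* (q₂ₑ n ·ₑ Mₑ (con (+ 1)) b (con (+ 0)) d) 3F
                 :+ con (+ 1) :* (δ :+ :- (con (+ 3) :* b))
                 :+ (:- (con (+ 3) :* b :* (d :* i :+ con (+ 1)))) :* (d :* i :+ :- con (+ 1))) refl δ n b d d⁻¹)
            δ≈3b dd⁻¹-1≈0

    module _ (m : Line) (m⊆Π∞ : LineInPlane m (Π ∞)) (P∞∉m : ¬ OnLine (P ∞) m) (¬L₁m : ¬ L₁ m) (¬L₄m : ¬ L₄ m) where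
      open LineInΠ∞ m m⊆Π∞ P∞∉m

      ℓ₀-onto-LineInΠ∞ : ∃[ a ] ∃[ b ] ∃[ c ] ∃[ d ] (det a b c d ≉ 0# × ImageUnder a b c d ℓ₀ m)
      ℓ₀-onto-LineInΠ∞ = by-cases (D ≟ 0#) (isSquare? D)
        where
        by-cases : Dec (D ≈ 0#) → Dec (IsSquare D) → ∃[ a ] ∃[ b ] ∃[ c ] ∃[ d ] (det a b c d ≉ 0# × ImageUnder a b c d ℓ₀ m)
        by-cases (yes D≈0) _ = ⊥-elim (¬L₁m (D≈0⇒L₁ D≈0))
        by-cases (no D≉0) (yes □D) = ⊥-elim (¬L₄m (D-square⇒L₄ D≉0 □D))
        by-cases (no _) (no ¬□D) = D-nonsquare⇒image ¬□D

    inOrbit⇒L₅ : ∀ ℓ → InOrbit ℓ₀ ℓ → L₅ ℓ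
    inOrbit⇒L₅ ℓ (a , b , c , d , D≉0 , im) = (u , lineInPlane-∝ {ℓ} (∝-sym Π∞↦Πu) ℓ⊆M⁻▷Π∞) , ¬L₁ , ¬L₂ , ¬L₃ , ¬L₄
      where
      g = projectivity a b c d D≉0
      u = proj₁ (CubicCollineation.plane⁻ g ∞)
      Π∞↦Πu = proj₂ (CubicCollineation.plane⁻ g ∞)
      ℓ⊆M⁻▷Π∞ : LineInPlane ℓ (M⁻ a b c d ▷ Π ∞)
      ℓ⊆M⁻▷Π∞ = lineInPlane-preimage (inverse g) {ℓ} {ℓ₀} {Π ∞} (image-inverse g {ℓ₀} {ℓ} im) ℓ₀⊆Π∞
      P∉ℓ : ∀ t → ¬ OnLine (P t) ℓ
      P∉ℓ t o = let s , o′ = cubePoint-preimage g {ℓ₀} {ℓ} {t} im o in P∉ℓ₀ s o′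
      ¬L₁ : ¬ L₁ ℓ
      ¬L₁ = ¬L₁ℓ₀ ∘ L₁-preimage g {ℓ₀} {ℓ} im
      ¬L₂ : ¬ L₂ ℓ
      ¬L₂ (fin t , tangent) = P∉ℓ (fin t) (proj₁ (proj₂ tangent))
      ¬L₂ (∞ , tangent) = P∉ℓ ∞ (proj₂ (proj₂ tangent))
      ¬L₃ : ¬ L₃ ℓ
      ¬L₃ (t , o , _) = P∉ℓ t o
      ¬L₄ : ¬ L₄ ℓ
      ¬L₄ = ¬L₄ℓ₀ ∘ L₄-preimage g {ℓ₀} {ℓ} im

    L₅⇒inOrbit : ∀ ℓ → L₅ ℓ → InOrbit ℓ₀ ℓ
    L₅⇒inOrbit ℓ ((t , ℓ⊆Πt) , ¬L₁ , ¬L₂ , ¬L₃ , ¬L₄) = via-Π∞ (toΠ∞ t)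
      where
      via-Π∞ : ∃[ a ] ∃[ b ] ∃[ c ] ∃[ d ] (det a b c d ≉ 0# × (M⁻ a b c d ▷ Π t) ∝ Π ∞) → InOrbit ℓ₀ ℓ
      via-Π∞ (a , b , c , d , D≉0 , Πt↦Π∞) =
        compose (ℓ₀-onto-LineInΠ∞ m m⊆Π∞ P∞∉m (¬L₁ ∘ L₁-preimage g {ℓ} {m} ℓ↦m) (¬L₄ ∘ L₄-preimage g {ℓ} {m} ℓ↦m))
        where
        g = projectivity a b c d D≉0
        m = imageLine g ℓ
        ℓ↦m : ImageBy (M a b c d) ℓ m
        ℓ↦m = imageLine-image g ℓ
        m↦ℓ : ImageBy (M⁻ a b c d) m ℓ
        m↦ℓ = image-inverse g {ℓ} {m} ℓ↦m
        m⊆Π∞ : LineInPlane m (Π ∞)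
        m⊆Π∞ = lineInPlane-∝ {m} (∝-sym Πt↦Π∞) (lineInPlane-preimage (inverse g) {m} {ℓ} {Π t} m↦ℓ ℓ⊆Πt)
        -- P ∞ ∈ m would put P t on ℓ ⊆ Π t, making ℓ tangent (L₂) or in L₃
        P∞∉m : ¬ OnLine (P ∞) m
        P∞∉m o = ¬L₃ (t , Pt∈ℓ , ℓ⊆Πt , ¬L₂ ∘ (t ,_))
          where
          u = proj₁ (cubePoint-preimage g {ℓ} {m} {∞} ℓ↦m o)
          Pu∈ℓ = proj₂ (cubePoint-preimage g {ℓ} {m} {∞} ℓ↦m o)
          u≈t : u ≈ₚ t
          u≈t = P-on-Π⇒≈ₚ u t (onPlane-inSpan {π = Π t} Pu∈ℓ (proj₁ ℓ⊆Πt) (proj₂ ℓ⊆Πt))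
          Pt∈ℓ : OnLine (P t) ℓ
          Pt∈ℓ = inSpan-∝ (≈⇒∝ (P-cong {t} {u} (≈ₚ-sym {u} {t} u≈t))) Pu∈ℓ
        compose : ∃[ a′ ] ∃[ b′ ] ∃[ c′ ] ∃[ d′ ] (det a′ b′ c′ d′ ≉ 0# × ImageUnder a′ b′ c′ d′ ℓ₀ m) → InOrbit ℓ₀ ℓ
        compose (a′ , b′ , c′ , d′ , D′≉0 , ℓ₀↦m) =
          a′ * d + b′ * (- c) , a′ * (- b) + b′ * a , c′ * d + d′ * (- c) , c′ * (- b) + d′ * a ,
          *-≉0 D′≉0 (D≉0 ∘ trans (sym (det-M⁻ a b c d))) ∘ trans (sym (det-· a′ b′ c′ d′ d (- b) (- c) a)) ,
          image-∘ {M a′ b′ c′ d′} {M⁻ a b c d} {M (a′ * d + b′ * (- c)) (a′ * (- b) + b′ * a) (c′ * d + d′ * (- c)) (c′ * (- b) + d′ * a)}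
                  {ℓ₀} {m} {ℓ} (M-· a′ b′ c′ d′ d (- b) (- c) a) ℓ₀↦m m↦ℓ

mainTheorem8 : (F : FiniteField) → Geometry.CharNot2Or3 F →
               Geometry.IsSingleOrbit F (Geometry.L₅ F)
mainTheorem8 F ch = ℓ₀ n ¬□n , L₅ℓ₀ n ¬□n , λ ℓ → mk⇔ (L₅⇒inOrbit n ¬□n ℓ) (inOrbit⇒L₅ n ¬□n ℓ)
  where
  open Orbit F ch
  n = proj₁ (Squares.nonSquare-exists F 2≉0)
  ¬□n = proj₂ (Squares.nonSquare-exists F 2≉0)
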